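{- Let $N$ be a binary matroid and $a\in E(N)$. If $N\backslash a\cong F_7^*$ and $N/a$ is graphic, then $N/a$ is isomorphic to $M(G_{10})$ or $M(G_{11})$, where $G_{10}$ is $K_4$ with one loop added at a vertex, and $G_{11}$ is the $4$-cycle $v_1v_2v_3v_4v_1$ in which each of the edges $v_1v_2,v_2v_3,v_3v_4$ is doubled by a parallel edge. -}

module Defs where

open import Data.Nat as ℕ using (ℕ; zero; suc; _<_)
open import Data.Fin using (Fin; zero; suc; toℕ; fromℕ<)
open import Data.Fin.Subset using (Subset; ⊥; ⁅_⁆; _∪_; _⊆_; _∈_; _∉_; ∣_∣)
open import Data.Bool using (Bool; true; false; _∧_; _xor_)
open import Data.Vec using (Vec; lookup; tabulate; insertAt; foldr)
open import Data.Product using (Σ; ∃-syntax; _×_; _,_)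
open import Data.Sum using (_⊎_)
open import Relation.Nullary using (¬_; yes; no)
open import Relation.Binary.PropositionalEquality using (_≡_)
open import Function.Bundles using (_⇔_; _↔_; Inverse)
open import Function.Definitions using (Injective)

IndepSys : ℕ → Set₁
IndepSys n = Subset n → Set

record Matroid (n : ℕ) : Set₁ where
  field
    indep : IndepSys n
    indep-∅ : indep ⊥
    indep-⊆ : ∀ {X Y} → Y ⊆ X → indep X → indep Y
    indep-aug : ∀ {X Y} → indep X → indep Y → ∣ X ∣ < ∣ Y ∣ →
                ∃[ e ] (e ∈ Y × e ∉ X × indep (X ∪ ⁅ e ⁆))
open Matroid public

-- Deletion M \ a : ground set E - a, identified with Fin n via insertAt.
delete : ∀ {n} → IndepSys (suc n) → Fin (suc n) → IndepSys n
delete I a X = I (insertAt X a false)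

contract : ∀ {n} → IndepSys (suc n) → Fin (suc n) → IndepSys n
contract I a X = (I ⁅ a ⁆ × I (insertAt X a true))
               ⊎ (¬ I ⁅ a ⁆ × I (insertAt X a false))

preimage : ∀ {n m} → (Fin n → Fin m) → Subset m → Subset n
preimage f Y = tabulate (λ i → lookup Y (f i))

_≅_ : ∀ {n m} → IndepSys n → IndepSys m → Set
_≅_ {n} {m} I J = Σ (Fin n ↔ Fin m) λ σ →
  ∀ (Y : Subset m) → I (preimage (Inverse.to σ) Y) ⇔ J Y

colSum : ∀ {r n} → (Fin r → Fin n → Bool) → Subset n → Fin r → Bool
colSum A Y i = foldr _ _xor_ false (tabulate (λ j → lookup Y j ∧ A i j))

LinIndep : ∀ {r n} → (Fin r → Fin n → Bool) → IndepSys n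
LinIndep A X = ∀ Y → Y ⊆ X → (∀ i → colSum A Y i ≡ false) → Y ≡ ⊥

IsBinary : ∀ {n} → Matroid n → Set
IsBinary {n} M = ∃[ r ] Σ (Fin r → Fin n → Bool) λ A →
  ∀ X → indep M X ⇔ LinIndep A X

-- F7* : the dual of the Fano matroid, as the vector matroid of its
-- standard GF(2)-representation [ Aᵀ | I₄ ] where F7 = M[ I₃ | A ],
-- A having columns 110, 101, 011, 111.

F7*Mat : Fin 4 → Fin 7 → Bool
F7*Mat zero zero = true
F7*Mat (suc zero) zero = true
F7*Mat (suc (suc zero)) zero = false
F7*Mat (suc (suc (suc zero))) zero = true
F7*Mat zero (suc zero) = true
F7*Mat (suc zero) (suc zero) = false
F7*Mat (suc (suc zero)) (suc zero) = true
F7*Mat (suc (suc (suc zero))) (suc zero) = true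
F7*Mat zero (suc (suc zero)) = false
F7*Mat (suc zero) (suc (suc zero)) = true
F7*Mat (suc (suc zero)) (suc (suc zero)) = true
F7*Mat (suc (suc (suc zero))) (suc (suc zero)) = true
F7*Mat i (suc (suc (suc j))) = unit i j
  where
  unit : ∀ {m} → Fin m → Fin m → Bool
  unit zero zero = true
  unit (suc i) (suc j) = unit i j
  unit _ _ = false

F7* : IndepSys 7
F7* = LinIndep F7*Mat

record Graph : Set where
  field
    V : ℕ
    E : ℕ
    ends : Fin E → Fin V × Fin V
open Graph public

next : ∀ {k} → Fin (suc k) → Fin (suc k)
next {k} i with suc (toℕ i) ℕ.<? suc k
... | yes p = fromℕ< p
... | no _ = zero

Joins : (G : Graph) → Fin (E G) → Fin (V G) → Fin (V G) → Set
Joins G e x y = ends G e ≡ (x , y) ⊎ ends G e ≡ (y , x)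

-- A cycle of G using only edges of X: distinct vertices v₀ … v_k and
-- distinct edges e₀ … e_k with e_i joining v_i and v_{i+1 mod (k+1)}.
-- (k = 0: a loop; k = 1: a pair of parallel edges.)
record CycleIn (G : Graph) (X : Subset (E G)) : Set where
  field
    k : ℕ
    vs : Fin (suc k) → Fin (V G)
    es : Fin (suc k) → Fin (E G)
    vs-inj : Injective _≡_ _≡_ vs
    es-inj : Injective _≡_ _≡_ es
    es-in : ∀ i → es i ∈ X
    es-joins : ∀ i → Joins G (es i) (vs i) (vs (next i))

CycleMatroid : (G : Graph) → IndepSys (E G)
CycleMatroid G X = ¬ CycleIn G X

IsGraphic : ∀ {n} → IndepSys n → Set
IsGraphic I = Σ Graph λ G → I ≅ CycleMatroid G

G₁₀ : Graph
G₁₀ = record { V = 4 ; E = 7 ; ends = f }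
  where
  f : Fin 7 → Fin 4 × Fin 4
  f zero = (zero , suc zero)
  f (suc zero) = (zero , suc (suc zero))
  f (suc (suc zero)) = (zero , suc (suc (suc zero)))
  f (suc (suc (suc zero))) = (suc zero , suc (suc zero))
  f (suc (suc (suc (suc zero)))) = (suc zero , suc (suc (suc zero)))
  f (suc (suc (suc (suc (suc zero))))) = (suc (suc zero) , suc (suc (suc zero)))
  f (suc (suc (suc (suc (suc (suc zero)))))) = (zero , zero)

-- G₁₁ : the 4-cycle v₁v₂v₃v₄v₁ (vertices 0,1,2,3) with each of the edges
-- v₁v₂, v₂v₃, v₃v₄ doubled by a parallel edge.
G₁₁ : Graph
G₁₁ = record { V = 4 ; E = 7 ; ends = f }
  where
  f : Fin 7 → Fin 4 × Fin 4
  f zero = (zero , suc zero)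
  f (suc zero) = (zero , suc zero)
  f (suc (suc zero)) = (suc zero , suc (suc zero))
  f (suc (suc (suc zero))) = (suc zero , suc (suc zero))
  f (suc (suc (suc (suc zero)))) = (suc (suc zero) , suc (suc (suc zero)))
  f (suc (suc (suc (suc (suc zero))))) = (suc (suc zero) , suc (suc (suc zero)))
  f (suc (suc (suc (suc (suc (suc zero)))))) = (suc (suc (suc zero)) , zero)

-- Move a to the end and represent N over GF(2) by a matrix B.  Its first seven columns represent
-- F7*, whose columns 3–6 are a basis; eliminating with the fundamental circuits of columns 0, 1, 2
-- shows that column 7 is either a coloop or the sum of a set S of the columns 3–6, and that the
-- same elimination decides every dependency of B.  So N, and with it N/a, is one of 17 explicit
-- matroids.  Three of these contractions are F7* or F7, which are not graphic: the vertex stars of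
-- a graph are orthogonal to its circuits, and the cocycles of F7* (of F7) would force a triangle
-- (a parallel pair) on edges that are independent.  The other fourteen are M(G₁₀) or M(G₁₁) after
-- an explicit relabelling, confirmed by exhaustive checks.

module Submission where

open import Defs

open import Algebra.Bundles using (CommutativeRing)
import Algebra.Properties.Semiring.Sum
open import Data.Bool using (Bool; true; false; not; T; _∧_; _∨_; _xor_; if_then_else_)
open import Data.Bool.ListAction using (all; any)
open import Data.Bool.Properties
  using (T-≡; T-not-≡; T-∧; T-∨; ⇔→≡; ∧-identityʳ; ∧-distribʳ-xor; xor-same; xor-assoc; xor-comm; xor-identityʳ;
         xor-∧-commutativeRing)
open import Data.Empty using () renaming (⊥ to Empty)
open import Data.Fin using (Fin; zero; suc; _≟_; toℕ; fromℕ; inject₁; punchIn; punchOut)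
open import Data.Fin.Patterns using (0F; 1F; 2F; 3F; 4F; 5F; 6F; 7F)
open import Data.Fin.Permutation using (Permutation; _⟨$⟩ʳ_; _⟨$⟩ˡ_; inverseˡ; inverseʳ; insert; insert-punchIn; ↔⇒≡)
open import Data.Fin.Properties
  using (any?; toℕ-injective; toℕ-fromℕ<; toℕ-inject₁; toℕ<n; toℕ-fromℕ; punchIn-punchOut)
open import Data.Fin.Subset using (Subset; ⊥; ⊤; ⁅_⁆; _∪_; _⊆_; _∈_; _∉_)
open import Data.Fin.Subset.Properties
  using (x∈⁅x⁆; x∈⁅y⁆⇒x≡y; ∉⊥; x∈p∪q⁺; drop-∷-⊆; out⊆; s⊆s; _⊆?_; _∈?_; ⊆-antisym; anySubset?)
open import Data.List using (List; []; _∷_)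
open import Data.List.Membership.Propositional using () renaming (_∈_ to _∈ₗ_)
import Data.List.Relation.Unary.All as All
open import Data.List.Relation.Unary.All.Properties using (all⁺; all⁻)
open import Data.List.Relation.Unary.Any using (satisfied) renaming (here to hereₗ; there to thereₗ)
open import Data.List.Relation.Unary.Any.Properties using (any⁻)
open import Data.Nat using (ℕ; zero; suc; s≤s; _<_; _<?_)
open import Data.Nat.Properties using (n≮n)
open import Data.Product using (Σ; ∃-syntax; _×_; _,_; proj₁; proj₂)
open import Data.Sum using (_⊎_; inj₁; inj₂; [_,_]′)
open import Data.Unit using (tt)
open import Data.Vec using (Vec; []; _∷_; lookup; tabulate; foldr; zipWith; insertAt; removeAt; _[_]≔_; toList; _[_]=_)
open import Data.Vec.Properties
  using (lookup∘tabulate; tabulate∘lookup; tabulate-cong; lookup-zipWith; lookup-replicate; []=⇒lookup; lookup⇒[]=;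
         lookup∘update′; insertAt-lookup; insertAt-punchIn; insertAt-removeAt)
open import Function using (_∘_; id; case_of_)
open import Function.Bundles using (_⇔_; mk⇔; Equivalence; _↔_; mk↔ₛ′)
open import Function.Construct.Composition using (_↔-∘_) renaming (equivalence to ⇔-trans)
open import Function.Construct.Symmetry using (↔-sym)
open import Function.Definitions using (Injective)
open import Function.Properties.Equivalence using (⇔-setoid)
open import Function.Related.TypeIsomorphisms using (¬-cong-⇔)
open import Level using (0ℓ)
open import Relation.Binary.PropositionalEquality
import Relation.Binary.Reasoning.Setoid
open import Relation.Nullary using (¬_; yes; no; Dec; does)
open import Relation.Nullary.Decidable using (isYes; dec-true; dec-false; _×-dec_; ¬?; decidable-stable; toWitness)
open import Relation.Nullary.Negation using (contradiction)

open _[_]=_ using (here; there)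
open Equivalence using (to; from)
open Algebra.Properties.Semiring.Sum (CommutativeRing.semiring xor-∧-commutativeRing)
  using (sum; sum-cong-≗; sum-replicate-zero; ∑-distrib-+; ∑-comm; ∑-permute; *-distribʳ-sum; sum-init-last)

module ⇔-Reasoning = Relation.Binary.Reasoning.Setoid (⇔-setoid 0ℓ)

-- Sums over GF(2) and kernels

sum-cong : ∀ {n} {f g : Fin n → Bool} → (∀ i → f i ≡ g i) → sum f ≡ sum g
sum-cong = sum-cong-≗

sum-zero : ∀ {n} (f : Fin n → Bool) → (∀ i → f i ≡ false) → sum f ≡ false
sum-zero {n} f f≗0 = trans (sum-cong f≗0) (sum-replicate-zero n)

foldr-xor-tabulate : ∀ {n} (f : Fin n → Bool) → foldr _ _xor_ false (tabulate f) ≡ sum f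
foldr-xor-tabulate {zero} f = refl
foldr-xor-tabulate {suc n} f = cong (f zero xor_) (foldr-xor-tabulate (f ∘ suc))

sumOver : ∀ {n} → Subset n → (Fin n → Bool) → Bool
sumOver Y g = foldr _ _xor_ false (tabulate λ j → lookup Y j ∧ g j)

sumOver≡sum : ∀ {n} (Y : Subset n) g → sumOver Y g ≡ sum (λ j → lookup Y j ∧ g j)
sumOver≡sum Y g = foldr-xor-tabulate (λ j → lookup Y j ∧ g j)

sumOver-cong : ∀ {n} (Y : Subset n) {g h} → (∀ j → g j ≡ h j) → sumOver Y g ≡ sumOver Y h
sumOver-cong Y g≗h = cong (foldr _ _xor_ false) (tabulate-cong λ j → cong (lookup Y j ∧_) (g≗h j))

infixl 6 _△_
_△_ : ∀ {n} → Subset n → Subset n → Subset n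
_△_ = zipWith _xor_

△-cancelʳ : ∀ {n} (Y W : Subset n) → (Y △ W) △ W ≡ Y
△-cancelʳ [] [] = refl
△-cancelʳ (y ∷ Y) (w ∷ W) =
  cong₂ _∷_ (trans (xor-assoc y w w) (trans (cong (y xor_) (xor-same w)) (xor-identityʳ y))) (△-cancelʳ Y W)

sumOver-△ : ∀ {n} (Y W : Subset n) g → sumOver (Y △ W) g ≡ sumOver Y g xor sumOver W g
sumOver-△ {n} Y W g = begin
  sumOver (Y △ W) g                          ≡⟨ sumOver≡sum (Y △ W) g ⟩
  sum (λ j → lookup (Y △ W) j ∧ g j)         ≡⟨ sum-cong distrib ⟩
  sum (λ j → Y∧g j xor W∧g j)                ≡⟨ ∑-distrib-+ Y∧g W∧g ⟩
  sum Y∧g xor sum W∧g                        ≡⟨ cong₂ _xor_ (sumOver≡sum Y g) (sumOver≡sum W g) ⟨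
  sumOver Y g xor sumOver W g                ∎
  where
  open ≡-Reasoning
  Y∧g W∧g : Fin n → Bool
  Y∧g j = lookup Y j ∧ g j
  W∧g j = lookup W j ∧ g j
  distrib : ∀ j → lookup (Y △ W) j ∧ g j ≡ Y∧g j xor W∧g j
  distrib j = trans (cong (_∧ g j) (lookup-zipWith _xor_ j Y W)) (∧-distribʳ-xor (g j) (lookup Y j) (lookup W j))

sumOver-⊥ : ∀ {n} g → sumOver {n} ⊥ g ≡ false
sumOver-⊥ {n} g = trans (sumOver≡sum ⊥ g)
  (sum-zero (λ j → lookup {n = n} ⊥ j ∧ g j) λ j → cong (_∧ g j) (lookup-replicate {n = n} j false))

sumOver-⁅⁆ : ∀ {n} (e : Fin n) g → sumOver ⁅ e ⁆ g ≡ g e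
sumOver-⁅⁆ zero g = trans (cong (g zero xor_) (sumOver-⊥ (g ∘ suc))) (xor-identityʳ _)
sumOver-⁅⁆ (suc e) g = sumOver-⁅⁆ e (g ∘ suc)

Kernel : ∀ {r n} → (Fin r → Fin n → Bool) → Subset n → Set
Kernel A Y = ∀ i → colSum A Y i ≡ false

kernel-⊥ : ∀ {r n} (A : Fin r → Fin n → Bool) → Kernel A ⊥
kernel-⊥ A i = sumOver-⊥ (A i)

kernel-△ : ∀ {r n} (A : Fin r → Fin n → Bool) Y W → Kernel A Y → Kernel A W → Kernel A (Y △ W)
kernel-△ A Y W Y∈ker W∈ker i = trans (sumOver-△ Y W (A i)) (cong₂ _xor_ (Y∈ker i) (W∈ker i))

lookup-preimage : ∀ {n m} (f : Fin n → Fin m) Y j → lookup (preimage f Y) j ≡ lookup Y (f j)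
lookup-preimage f Y j = lookup∘tabulate _ j

∈⇔lookup : ∀ {n} {x : Fin n} {Y} → x ∈ Y ⇔ lookup Y x ≡ true
∈⇔lookup {x = x} {Y} = mk⇔ []=⇒lookup (lookup⇒[]= x Y)

subset-ext : ∀ {n} {Y W : Subset n} → (∀ j → lookup Y j ≡ lookup W j) → Y ≡ W
subset-ext {Y = Y} {W} Y≗W = trans (sym (tabulate∘lookup Y)) (trans (tabulate-cong Y≗W) (tabulate∘lookup W))

preimage-⊆ : ∀ {n m} (f : Fin n → Fin m) {Y W} → Y ⊆ W → preimage f Y ⊆ preimage f W
preimage-⊆ f {Y} {W} Y⊆W {x} x∈ = from ∈⇔lookup (trans (lookup-preimage f W x)
  (to ∈⇔lookup (Y⊆W (from ∈⇔lookup (trans (sym (lookup-preimage f Y x)) (to ∈⇔lookup x∈))))))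

preimage-∘ : ∀ {n m k} (f : Fin n → Fin m) (g : Fin m → Fin k) Y → preimage f (preimage g Y) ≡ preimage (g ∘ f) Y
preimage-∘ f g Y = subset-ext λ j →
  trans (lookup-preimage f (preimage g Y) j) (trans (lookup-preimage g Y (f j)) (sym (lookup-preimage (g ∘ f) Y j)))

preimage-inverse : ∀ {n m} (f : Fin n → Fin m) (g : Fin m → Fin n) → (∀ x → g (f x) ≡ x) →
                   ∀ Y → preimage f (preimage g Y) ≡ Y
preimage-inverse f g g∘f≗id Y = trans (preimage-∘ f g Y)
  (subset-ext λ j → trans (lookup-preimage (g ∘ f) Y j) (cong (lookup Y) (g∘f≗id j)))

preimage-⊥ : ∀ {n m} (f : Fin n → Fin m) → preimage f ⊥ ≡ ⊥
preimage-⊥ {n} {m} f = subset-ext λ j →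
  trans (lookup-preimage f ⊥ j) (trans (lookup-replicate {n = m} (f j) false) (sym (lookup-replicate {n = n} j false)))

sumOver-preimage : ∀ {m n} (π : Permutation m n) (Y : Subset n) g →
                   sumOver (preimage (π ⟨$⟩ʳ_) Y) g ≡ sumOver Y (g ∘ (π ⟨$⟩ˡ_))
sumOver-preimage {m} π Y g = begin
  sumOver πY g                             ≡⟨ sumOver≡sum πY g ⟩
  sum πY∧g                                 ≡⟨ ∑-permute πY∧g (↔-sym π) ⟩
  sum (πY∧g ∘ (π ⟨$⟩ˡ_))                   ≡⟨ sum-cong (λ j → cong (_∧ g (π ⟨$⟩ˡ j)) (lookup-πY j)) ⟩
  sum (λ j → lookup Y j ∧ g (π ⟨$⟩ˡ j))    ≡⟨ sumOver≡sum Y (g ∘ (π ⟨$⟩ˡ_)) ⟨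
  sumOver Y (g ∘ (π ⟨$⟩ˡ_))                ∎
  where
  open ≡-Reasoning
  πY = preimage (π ⟨$⟩ʳ_) Y
  πY∧g : Fin m → Bool
  πY∧g w = lookup πY w ∧ g w
  lookup-πY : ∀ j → lookup πY (π ⟨$⟩ˡ j) ≡ lookup Y j
  lookup-πY j = trans (lookup-preimage (π ⟨$⟩ʳ_) Y (π ⟨$⟩ˡ j)) (cong (lookup Y) (inverseʳ π))

permuteColumns : ∀ {r n} → (Fin r → Fin n → Bool) → Permutation n n → Fin r → Fin n → Bool
permuteColumns A π i k = A i (π ⟨$⟩ˡ k)

colSum-permuteColumns : ∀ {r n} (A : Fin r → Fin n → Bool) (π : Permutation n n) Y i →
                        colSum A (preimage (π ⟨$⟩ʳ_) Y) i ≡ colSum (permuteColumns A π) Y i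
colSum-permuteColumns A π Y i = sumOver-preimage π Y (A i)

linIndep-permuteColumns : ∀ {r n} (A : Fin r → Fin n → Bool) (π : Permutation n n) Y →
                          LinIndep A (preimage (π ⟨$⟩ʳ_) Y) ⇔ LinIndep (permuteColumns A π) Y
linIndep-permuteColumns A π Y = mk⇔ ⇒ ⇐
  where
  π⁻¹∘π : ∀ W → preimage (π ⟨$⟩ˡ_) (preimage (π ⟨$⟩ʳ_) W) ≡ W
  π⁻¹∘π = preimage-inverse (π ⟨$⟩ˡ_) (π ⟨$⟩ʳ_) (λ _ → inverseʳ π)
  π∘π⁻¹ : ∀ W → preimage (π ⟨$⟩ʳ_) (preimage (π ⟨$⟩ˡ_) W) ≡ W
  π∘π⁻¹ = preimage-inverse (π ⟨$⟩ʳ_) (π ⟨$⟩ˡ_) (λ _ → inverseˡ π)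
  ⇒ : LinIndep A (preimage (π ⟨$⟩ʳ_) Y) → LinIndep (permuteColumns A π) Y
  ⇒ indep W W⊆Y W∈ker = begin
    W                                            ≡⟨ π⁻¹∘π W ⟨
    preimage (π ⟨$⟩ˡ_) (preimage (π ⟨$⟩ʳ_) W)    ≡⟨ cong (preimage (π ⟨$⟩ˡ_)) πW≡⊥ ⟩
    preimage (π ⟨$⟩ˡ_) ⊥                         ≡⟨ preimage-⊥ (π ⟨$⟩ˡ_) ⟩
    ⊥                                            ∎
    where
    open ≡-Reasoning
    πW≡⊥ : preimage (π ⟨$⟩ʳ_) W ≡ ⊥
    πW≡⊥ = indep (preimage (π ⟨$⟩ʳ_) W) (preimage-⊆ (π ⟨$⟩ʳ_) W⊆Y) λ i → trans (colSum-permuteColumns A π W i) (W∈ker i)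
  ⇐ : LinIndep (permuteColumns A π) Y → LinIndep A (preimage (π ⟨$⟩ʳ_) Y)
  ⇐ indep W W⊆πY W∈ker = begin
    W                                            ≡⟨ π∘π⁻¹ W ⟨
    preimage (π ⟨$⟩ʳ_) W′                        ≡⟨ cong (preimage (π ⟨$⟩ʳ_)) (indep W′ W′⊆Y W′∈ker) ⟩
    preimage (π ⟨$⟩ʳ_) ⊥                         ≡⟨ preimage-⊥ (π ⟨$⟩ʳ_) ⟩
    ⊥                                            ∎
    where
    open ≡-Reasoning
    W′ = preimage (π ⟨$⟩ˡ_) W
    W′⊆Y : W′ ⊆ Y
    W′⊆Y = subst (W′ ⊆_) (π⁻¹∘π Y) (preimage-⊆ (π ⟨$⟩ˡ_) W⊆πY)
    W′∈ker : Kernel (permuteColumns A π) W′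
    W′∈ker i = trans (sym (colSum-permuteColumns A π W′ i)) (subst (λ U → colSum A U i ≡ false) (sym (π∘π⁻¹ W)) (W∈ker i))

infixr 4 _,ᵇ_
_,ᵇ_ : ∀ {a b} → T a → T b → T (a ∧ b)
ta ,ᵇ tb = from T-∧ (ta , tb)

T-∧₃ : ∀ {a b c} → T (a ∧ b ∧ c) → T a × T b × T c
T-∧₃ {a} t = let ta , tbc = to (T-∧ {a}) t in ta , to T-∧ tbc

infixr 1 _⇒ᵇ_
_⇒ᵇ_ : Bool → Bool → Bool
a ⇒ᵇ b = not a ∨ b

⇒ᵇ-elim : ∀ {a b} → T (a ⇒ᵇ b) → T a → T b
⇒ᵇ-elim {true} t _ = t

every : ∀ n → (Fin n → Bool) → Bool
every zero p = true
every (suc n) p = p zero ∧ every n (p ∘ suc)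

every-sound : ∀ n p → T (every n p) → ∀ i → T (p i)
every-sound (suc n) p t zero = proj₁ (to T-∧ t)
every-sound (suc n) p t (suc i) = every-sound n (p ∘ suc) (proj₂ (to (T-∧ {p zero}) t)) i

every-complete : ∀ n p → (∀ i → T (p i)) → T (every n p)
every-complete zero p ∀p = tt
every-complete (suc n) p ∀p = from T-∧ (∀p zero , every-complete n (p ∘ suc) (∀p ∘ suc))

every²-sound : ∀ m n (p : Fin m → Fin n → Bool) → T (every m λ i → every n (p i)) → ∀ i j → T (p i j)
every²-sound m n p t i = every-sound n (p i) (every-sound m (λ i → every n (p i)) t i)

every³-sound : ∀ l m n (p : Fin l → Fin m → Fin n → Bool) →
               T (every l λ i → every m λ j → every n (p i j)) →
               ∀ i j k → T (p i j k)
every³-sound l m n p t i = every²-sound m n (p i) (every-sound l (λ i → every m λ j → every n (p i j)) t i)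

some : ∀ n → (Fin n → Bool) → Bool
some zero p = false
some (suc n) p = p zero ∨ some n (p ∘ suc)

some-sound : ∀ n p → T (some n p) → ∃[ i ] T (p i)
some-sound (suc n) p t with to (T-∨ {p zero}) t
... | inj₁ p₀ = zero , p₀
... | inj₂ t′ = let i , pᵢ = some-sound n (p ∘ suc) t′ in suc i , pᵢ

everySubset : ∀ n → (Subset n → Bool) → Bool
everySubset zero p = p []
everySubset (suc n) p = everySubset n (p ∘ (false ∷_)) ∧ everySubset n (p ∘ (true ∷_))

everySubset-sound : ∀ n p → T (everySubset n p) → ∀ Y → T (p Y)
everySubset-sound zero p t [] = t
everySubset-sound (suc n) p t (false ∷ Y) = everySubset-sound n _ (proj₁ (to T-∧ t)) Y
everySubset-sound (suc n) p t (true ∷ Y) =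
  everySubset-sound n _ (proj₂ (to (T-∧ {everySubset n (p ∘ (false ∷_))}) t)) Y

everySubsetOf : ∀ {n} → Subset n → (Subset n → Bool) → Bool
everySubsetOf [] p = p []
everySubsetOf (false ∷ X) p = everySubsetOf X (p ∘ (false ∷_))
everySubsetOf (true ∷ X) p = everySubsetOf X (p ∘ (false ∷_)) ∧ everySubsetOf X (p ∘ (true ∷_))

T-everySubsetOf : ∀ {n} (X : Subset n) p → T (everySubsetOf X p) ⇔ (∀ Y → Y ⊆ X → T (p Y))
T-everySubsetOf X p = mk⇔ (sound X p) (complete X p)
  where
  sound : ∀ {n} (X : Subset n) p → T (everySubsetOf X p) → ∀ Y → Y ⊆ X → T (p Y)
  sound [] p t [] _ = t
  sound (false ∷ X) p t (false ∷ Y) Y⊆X = sound X _ t Y (drop-∷-⊆ Y⊆X)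
  sound (false ∷ X) p t (true ∷ Y) Y⊆X with Y⊆X here
  ... | ()
  sound (true ∷ X) p t (false ∷ Y) Y⊆X = sound X _ (proj₁ (to T-∧ t)) Y (drop-∷-⊆ Y⊆X)
  sound (true ∷ X) p t (true ∷ Y) Y⊆X =
    sound X _ (proj₂ (to (T-∧ {everySubsetOf X (p ∘ (false ∷_))}) t)) Y (drop-∷-⊆ Y⊆X)
  complete : ∀ {n} (X : Subset n) p → (∀ Y → Y ⊆ X → T (p Y)) → T (everySubsetOf X p)
  complete [] p ∀p = ∀p [] λ ()
  complete (false ∷ X) p ∀p = complete X _ λ Y Y⊆X → ∀p (false ∷ Y) (out⊆ Y⊆X)
  complete (true ∷ X) p ∀p = from T-∧
    ( complete X _ (λ Y Y⊆X → ∀p (false ∷ Y) (out⊆ Y⊆X))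
    , complete X _ (λ Y Y⊆X → ∀p (true ∷ Y) (s⊆s Y⊆X)))

isEmpty : ∀ {n} → Subset n → Bool
isEmpty [] = true
isEmpty (b ∷ Y) = not b ∧ isEmpty Y

T-isEmpty : ∀ {n} {Y : Subset n} → T (isEmpty Y) ⇔ Y ≡ ⊥
T-isEmpty = mk⇔ sound complete
  where
  sound : ∀ {n} {Y : Subset n} → T (isEmpty Y) → Y ≡ ⊥
  sound {Y = []} _ = refl
  sound {Y = false ∷ Y} t = cong (false ∷_) (sound t)
  complete : ∀ {n} {Y : Subset n} → Y ≡ ⊥ → T (isEmpty Y)
  complete {Y = []} _ = tt
  complete {Y = false ∷ Y} refl = complete {Y = Y} refl

IndepOf : ∀ {n} → (Subset n → Set) → Subset n → Set
IndepOf P X = ∀ Y → Y ⊆ X → P Y → Y ≡ ⊥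

indepOfᵇ : ∀ {n} → (Subset n → Bool) → Subset n → Bool
indepOfᵇ P X = everySubsetOf X λ Y → isEmpty Y ∨ not (P Y)

T-indepOfᵇ : ∀ {n} (P : Subset n → Bool) X → T (indepOfᵇ P X) ⇔ IndepOf (T ∘ P) X
T-indepOfᵇ {n} P X = mk⇔
  (λ t Y (Y⊆X : Y ⊆ X) → case-empty (to (T-∨ {isEmpty Y}) (to (T-everySubsetOf X emptyOrNotP) t Y Y⊆X)))
  (λ indep → from (T-everySubsetOf X emptyOrNotP) λ Y (Y⊆X : Y ⊆ X) → decide Y (indep Y Y⊆X))
  where
  emptyOrNotP : Subset n → Bool
  emptyOrNotP Y = isEmpty Y ∨ not (P Y)
  case-empty : ∀ {Y} → T (isEmpty Y) ⊎ T (not (P Y)) → T (P Y) → Y ≡ ⊥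
  case-empty (inj₁ empty) _ = to T-isEmpty empty
  case-empty {Y} (inj₂ ¬pY) pY = contradiction pY (subst T (to T-not-≡ ¬pY))
  decide : ∀ Y → (T (P Y) → Y ≡ ⊥) → T (isEmpty Y ∨ not (P Y))
  decide Y pY⇒∅ with P Y
  ... | true = from (T-∨ {isEmpty Y}) (inj₁ (from T-isEmpty (pY⇒∅ tt)))
  ... | false = from (T-∨ {isEmpty Y}) (inj₂ tt)

isCircuitᵇ : ∀ {n} → (Subset n → Bool) → Subset n → Bool
isCircuitᵇ {n} ind C = not (ind C) ∧ every n λ x → lookup C x ⇒ᵇ ind (C [ x ]≔ false)

kernelᵇ : ∀ {r n} → (Fin r → Fin n → Bool) → Subset n → Bool
kernelᵇ {r} A Y = every r λ i → not (colSum A Y i)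

T-kernelᵇ : ∀ {r n} (A : Fin r → Fin n → Bool) Y → T (kernelᵇ A Y) ⇔ Kernel A Y
T-kernelᵇ {r} A Y = mk⇔
  (λ t i → to T-not-≡ (every-sound r _ t i))
  (λ Y∈ker → every-complete r _ λ i → from T-not-≡ (Y∈ker i))

kernel? : ∀ {r n} (A : Fin r → Fin n → Bool) Y → Dec (Kernel A Y)
kernel? A Y with kernelᵇ A Y in eq
... | true = yes (to (T-kernelᵇ A Y) (subst T (sym eq) tt))
... | false = no λ Y∈ker → subst T eq (from (T-kernelᵇ A Y) Y∈ker)

T-linIndepᵇ : ∀ {r n} (A : Fin r → Fin n → Bool) X → T (indepOfᵇ (kernelᵇ A) X) ⇔ LinIndep A X
T-linIndepᵇ A X = mk⇔
  (λ t Y (Y⊆X : Y ⊆ X) Y∈ker → to (T-indepOfᵇ (kernelᵇ A) X) t Y Y⊆X (from (T-kernelᵇ A Y) Y∈ker))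
  (λ indep → from (T-indepOfᵇ (kernelᵇ A) X) λ Y (Y⊆X : Y ⊆ X) t → indep Y Y⊆X (to (T-kernelᵇ A Y) t))

∈-remove : ∀ {n} {x y : Fin n} {K} → y ≢ x → y ∈ K → y ∈ K [ x ]≔ false
∈-remove {x = x} {y} {K} y≢x y∈K =
  from ∈⇔lookup (trans (lookup∘update′ y≢x K false) (to ∈⇔lookup y∈K))

kernel-circuit : ∀ {r n} (A : Fin r → Fin n → Bool) K →
                 (∀ x → x ∈ K → LinIndep A (K [ x ]≔ false)) → ¬ LinIndep A K → Kernel A K
kernel-circuit A K K-x-indep K-dep with kernel? A K
... | yes K∈ker = K∈ker
... | no K∉ker = contradiction K-indep K-dep
  where
  K-indep : LinIndep A K
  K-indep Y Y⊆K Y∈ker with any? (λ x → x ∈? K ×-dec ¬? (x ∈? Y))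
  ... | yes (x , x∈K , x∉Y) =
    K-x-indep x x∈K Y (λ y∈Y → ∈-remove (λ { refl → x∉Y y∈Y }) (Y⊆K y∈Y)) Y∈ker
  ... | no ∄x = contradiction (subst (Kernel A) (⊆-antisym Y⊆K K⊆Y) Y∈ker) K∉ker
    where
    K⊆Y : K ⊆ Y
    K⊆Y {x} x∈K = decidable-stable (x ∈? Y) λ x∉Y → ∄x (x , x∈K , x∉Y)

eliminate : ∀ {n} → Fin n → Subset n → Subset n → Subset n
eliminate j K Y with lookup Y j
... | true = Y △ K
... | false = Y

kernel-eliminate : ∀ {r n} (A : Fin r → Fin n → Bool) j K → Kernel A K →
                   ∀ Y → Kernel A (eliminate j K Y) ⇔ Kernel A Y
kernel-eliminate A j K K∈ker Y with lookup Y j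
... | true = mk⇔
  (λ Y△K∈ker → subst (Kernel A) (△-cancelʳ Y K) (kernel-△ A (Y △ K) K Y△K∈ker K∈ker))
  (λ Y∈ker → kernel-△ A Y K Y∈ker K∈ker)
... | false = mk⇔ id id

-- If ρ preserves and reflects the kernel and lands in an independent set Bs, then Y is in the
-- kernel iff ρ Y = ∅; so independence is decided by ρ alone.
linIndep-via-reduction : ∀ {r n} (A : Fin r → Fin n → Bool) (ρ : Subset n → Subset n) Bs →
  (∀ Y → ρ Y ⊆ Bs) → LinIndep A Bs → (∀ Y → Kernel A (ρ Y) ⇔ Kernel A Y) →
  ∀ U → LinIndep A U ⇔ T (indepOfᵇ (isEmpty ∘ ρ) U)
linIndep-via-reduction A ρ Bs ρ⊆Bs Bs-indep ρ-kernel U = mk⇔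
  (λ indep → from (T-indepOfᵇ (isEmpty ∘ ρ) U) λ Y (Y⊆U : Y ⊆ U) ρY≡⊥ →
     indep Y Y⊆U (to (ρ-kernel Y) (subst (Kernel A) (sym (to (T-isEmpty {Y = ρ Y}) ρY≡⊥)) (kernel-⊥ A))))
  (λ t Y (Y⊆U : Y ⊆ U) Y∈ker → to (T-indepOfᵇ (isEmpty ∘ ρ) U) t Y Y⊆U
     (from (T-isEmpty {Y = ρ Y}) (Bs-indep (ρ Y) (ρ⊆Bs Y) (from (ρ-kernel Y) Y∈ker))))

-- Single-element extensions of F7*

-- F7*Mat has the unit vectors as columns 3–6, so columns 0, 1, 2 have the fundamental
-- circuits below, and a new column 7 in their span is a vector S ∈ GF(2)⁴.
data Extension : Set where
  coloop : Extension
  inSpan : Subset 4 → Extension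

onBasis : Subset 4 → Bool → Subset 8
onBasis (s₃ ∷ s₄ ∷ s₅ ∷ s₆ ∷ []) b = false ∷ false ∷ false ∷ s₃ ∷ s₄ ∷ s₅ ∷ s₆ ∷ b ∷ []

circuit₀ circuit₁ circuit₂ : Subset 8
circuit₀ = true ∷ false ∷ false ∷ true ∷ true ∷ false ∷ true ∷ false ∷ []
circuit₁ = false ∷ true ∷ false ∷ true ∷ false ∷ true ∷ true ∷ false ∷ []
circuit₂ = false ∷ false ∷ true ∷ false ∷ true ∷ true ∷ true ∷ false ∷ []

toBasis : Subset 8 → Subset 8
toBasis = eliminate 2F circuit₂ ∘ eliminate 1F circuit₁ ∘ eliminate 0F circuit₀

reduce : Extension → Subset 8 → Subset 8
reduce coloop = toBasis
reduce (inSpan S) = eliminate 7F (onBasis S true) ∘ toBasis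

toBasis-⊆ : ∀ Y → toBasis Y ⊆ onBasis ⊤ true
toBasis-⊆ Y = toWitness {a? = toBasis Y ⊆? onBasis ⊤ true}
  (everySubset-sound 8 (λ Y → isYes (toBasis Y ⊆? onBasis ⊤ true)) tt Y)

reduce-inSpan-⊆ : ∀ S Y → reduce (inSpan S) Y ⊆ onBasis ⊤ false
reduce-inSpan-⊆ S Y = toWitness {a? = reduce (inSpan S) Y ⊆? onBasis ⊤ false}
  (everySubset-sound 8 (reduced S) (everySubset-sound 4 (everySubset 8 ∘ reduced) checked S) Y)
  where
  reduced : Subset 4 → Subset 8 → Bool
  reduced S Y = isYes (reduce (inSpan S) Y ⊆? onBasis ⊤ false)
  checked : T (everySubset 4 λ S → everySubset 8 (reduced S))
  checked = tt

onBasis-⊆ : ∀ S → onBasis S false ⊆ onBasis ⊤ false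
onBasis-⊆ S = toWitness {a? = onBasis S false ⊆? onBasis ⊤ false}
  (everySubset-sound 4 (λ S → isYes (onBasis S false ⊆? onBasis ⊤ false)) tt S)

onBasis-cover : ∀ Y → Y ⊆ onBasis ⊤ true → ∃[ S ] ∃[ b ] Y ≡ onBasis S b
onBasis-cover (false ∷ false ∷ false ∷ y₃ ∷ y₄ ∷ y₅ ∷ y₆ ∷ y₇ ∷ []) _ = y₃ ∷ y₄ ∷ y₅ ∷ y₆ ∷ [] , y₇ , refl
onBasis-cover (true ∷ _) Y⊆ with Y⊆ here
... | ()
onBasis-cover (false ∷ true ∷ _) Y⊆ with Y⊆ (there here)
... | there ()
onBasis-cover (false ∷ false ∷ true ∷ _) Y⊆ with Y⊆ (there (there here))
... | there (there ())

module ExtensionOfF7* {r} (B : Fin r → Fin 8 → Bool) (B-F7* : ∀ Y → LinIndep B (insertAt Y 7F false) ⇔ F7* Y) where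

  linIndep-avoiding-7 : ∀ U → lookup U 7F ≡ false → LinIndep B U ⇔ T (indepOfᵇ (kernelᵇ F7*Mat) (removeAt U 7F))
  linIndep-avoiding-7 U 7∉U = begin
    LinIndep B U                                        ≡⟨ cong (LinIndep B) U-7+7≡U ⟨
    LinIndep B (insertAt (removeAt U 7F) 7F false)      ≈⟨ B-F7* (removeAt U 7F) ⟩
    F7* (removeAt U 7F)                                 ≈⟨ T-linIndepᵇ F7*Mat (removeAt U 7F) ⟨
    T (indepOfᵇ (kernelᵇ F7*Mat) (removeAt U 7F))       ∎
    where
    open ⇔-Reasoning
    U-7+7≡U : insertAt (removeAt U 7F) 7F false ≡ U
    U-7+7≡U = trans (cong (insertAt (removeAt U 7F) 7F) (sym 7∉U)) (insertAt-removeAt U 7F)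

  indep₇ᵇ : Subset 8 → Bool
  indep₇ᵇ U = not (lookup U 7F) ∧ indepOfᵇ (kernelᵇ F7*Mat) (removeAt U 7F)

  linIndep-indep₇ᵇ : ∀ U → T (indep₇ᵇ U) → LinIndep B U
  linIndep-indep₇ᵇ U t = let 7∉U , U-7-indep = to (T-∧ {not (lookup U 7F)}) t
                         in from (linIndep-avoiding-7 U (to T-not-≡ 7∉U)) U-7-indep

  kernel-F7*-circuit : ∀ K → T (not (lookup K 7F) ∧ isCircuitᵇ indep₇ᵇ K) → Kernel B K
  kernel-F7*-circuit K t = kernel-circuit B K removal-indep K-dependent
    where
    7∉K : T (not (lookup K 7F))
    7∉K = proj₁ (T-∧₃ {not (lookup K 7F)} {not (indep₇ᵇ K)} t)
    dependent : T (not (indep₇ᵇ K))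
    dependent = proj₁ (proj₂ (T-∧₃ {not (lookup K 7F)} {not (indep₇ᵇ K)} t))
    minimal : T (every 8 λ x → lookup K x ⇒ᵇ indep₇ᵇ (K [ x ]≔ false))
    minimal = proj₂ (proj₂ (T-∧₃ {not (lookup K 7F)} {not (indep₇ᵇ K)} t))
    removal-indep : ∀ x → x ∈ K → LinIndep B (K [ x ]≔ false)
    removal-indep x x∈K = linIndep-indep₇ᵇ (K [ x ]≔ false)
      (⇒ᵇ-elim (every-sound 8 (λ x → lookup K x ⇒ᵇ indep₇ᵇ (K [ x ]≔ false)) minimal x) (from T-≡ (to ∈⇔lookup x∈K)))
    K-dependent : ¬ LinIndep B K
    K-dependent indep = subst T (to T-not-≡ dependent) (7∉K ,ᵇ to (linIndep-avoiding-7 K (to T-not-≡ 7∉K)) indep)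

  toBasis-kernel : ∀ Y → Kernel B (toBasis Y) ⇔ Kernel B Y
  toBasis-kernel Y = begin
    Kernel B (eliminate 2F circuit₂ Y₁)    ≈⟨ kernel-eliminate B 2F circuit₂ (kernel-F7*-circuit circuit₂ tt) Y₁ ⟩
    Kernel B Y₁                            ≈⟨ kernel-eliminate B 1F circuit₁ (kernel-F7*-circuit circuit₁ tt) Y₀ ⟩
    Kernel B Y₀                            ≈⟨ kernel-eliminate B 0F circuit₀ (kernel-F7*-circuit circuit₀ tt) Y ⟩
    Kernel B Y                             ∎
    where
    open ⇔-Reasoning
    Y₀ = eliminate 0F circuit₀ Y
    Y₁ = eliminate 1F circuit₁ Y₀

  basis-indep : LinIndep B (onBasis ⊤ false)
  basis-indep = linIndep-indep₇ᵇ (onBasis ⊤ false) tt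

  classify : Σ Extension λ c → ∀ U → LinIndep B U ⇔ T (indepOfᵇ (isEmpty ∘ reduce c) U)
  classify with anySubset? (λ S → kernel? B (onBasis S true))
  ... | yes (S , S∈ker) = inSpan S , linIndep-via-reduction B (reduce (inSpan S)) (onBasis ⊤ false)
          (reduce-inSpan-⊆ S) basis-indep
          λ Y → ⇔-trans (kernel-eliminate B 7F (onBasis S true) S∈ker (toBasis Y)) (toBasis-kernel Y)
  ... | no ∄S = coloop , linIndep-via-reduction B toBasis (onBasis ⊤ true) toBasis-⊆ basis′-indep toBasis-kernel
    where
    basis′-indep : LinIndep B (onBasis ⊤ true)
    basis′-indep Y Y⊆ Y∈ker with onBasis-cover Y Y⊆
    ... | S , false , refl = basis-indep (onBasis S false) (onBasis-⊆ S) Y∈ker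
    ... | S , true , refl = contradiction (S , Y∈ker) ∄S

insert-self : ∀ {m n} (i : Fin (suc m)) (j : Fin (suc n)) (π : Permutation m n) → insert i j π ⟨$⟩ʳ i ≡ j
insert-self i j π with i ≟ i
... | yes _ = refl
... | no i≢i = contradiction refl i≢i

⁅⁆≡insertAt : ∀ {n} (a : Fin (suc n)) → ⁅ a ⁆ ≡ insertAt ⊥ a true
⁅⁆≡insertAt zero = refl
⁅⁆≡insertAt {suc n} (suc a) = cong (false ∷_) (⁅⁆≡insertAt a)

preimage-insert : ∀ {n} (a : Fin (suc n)) (σ : Permutation n n) Y b →
  insertAt (preimage (σ ⟨$⟩ʳ_) Y) a b ≡ preimage (insert a (fromℕ n) σ ⟨$⟩ʳ_) (insertAt Y (fromℕ n) b)
preimage-insert {n} a σ Y b = subset-ext pointwise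
  where
  ρ = insert a (fromℕ n) σ
  Y⁺ = insertAt Y (fromℕ n) b
  lhs rhs : Fin (suc n) → Bool
  lhs = lookup (insertAt (preimage (σ ⟨$⟩ʳ_) Y) a b)
  rhs = lookup (preimage (ρ ⟨$⟩ʳ_) Y⁺)
  pointwise : ∀ j → lhs j ≡ rhs j
  pointwise j with a ≟ j
  ... | yes refl = begin
    lhs a                   ≡⟨ insertAt-lookup (preimage (σ ⟨$⟩ʳ_) Y) a b ⟩
    b                       ≡⟨ insertAt-lookup Y (fromℕ n) b ⟨
    lookup Y⁺ (fromℕ n)     ≡⟨ cong (lookup Y⁺) (insert-self a (fromℕ n) σ) ⟨
    lookup Y⁺ (ρ ⟨$⟩ʳ a)    ≡⟨ lookup-preimage (ρ ⟨$⟩ʳ_) Y⁺ a ⟨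
    rhs a                   ∎
    where open ≡-Reasoning
  ... | no a≢j = subst (λ j → lhs j ≡ rhs j) (punchIn-punchOut a≢j) (begin
    lhs (punchIn a k)                          ≡⟨ insertAt-punchIn (preimage (σ ⟨$⟩ʳ_) Y) a b k ⟩
    lookup (preimage (σ ⟨$⟩ʳ_) Y) k            ≡⟨ lookup-preimage (σ ⟨$⟩ʳ_) Y k ⟩
    lookup Y (σ ⟨$⟩ʳ k)                        ≡⟨ insertAt-punchIn Y (fromℕ n) b (σ ⟨$⟩ʳ k) ⟨
    lookup Y⁺ (punchIn (fromℕ n) (σ ⟨$⟩ʳ k))   ≡⟨ cong (lookup Y⁺) (insert-punchIn a (fromℕ n) σ k) ⟨
    lookup Y⁺ (ρ ⟨$⟩ʳ punchIn a k)             ≡⟨ lookup-preimage (ρ ⟨$⟩ʳ_) Y⁺ (punchIn a k) ⟨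
    rhs (punchIn a k)                          ∎)
    where
    open ≡-Reasoning
    k = punchOut a≢j

module _ {n} (I : IndepSys (suc n)) (a : Fin (suc n)) (σ : Permutation n n) where

  private
    ρ : Permutation (suc n) (suc n)
    ρ = insert a (fromℕ n) σ

  delete-relabel : ∀ Y → delete I a (preimage (σ ⟨$⟩ʳ_) Y) ≡ delete (I ∘ preimage (ρ ⟨$⟩ʳ_)) (fromℕ n) Y
  delete-relabel Y = cong I (preimage-insert a σ Y false)

  contract-relabel : ∀ Y → contract I a (preimage (σ ⟨$⟩ʳ_) Y) ≡ contract (I ∘ preimage (ρ ⟨$⟩ʳ_)) (fromℕ n) Y
  contract-relabel Y = cong₂ (λ ⁅a⁆ U → (I ⁅a⁆ × I (proj₁ U)) ⊎ (¬ I ⁅a⁆ × I (proj₂ U)))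
    ⁅a⁆-relabel (cong₂ _,_ (preimage-insert a σ Y true) (preimage-insert a σ Y false))
    where
    open ≡-Reasoning
    ⁅a⁆-relabel : ⁅ a ⁆ ≡ preimage (ρ ⟨$⟩ʳ_) ⁅ fromℕ n ⁆
    ⁅a⁆-relabel = begin
      ⁅ a ⁆                                              ≡⟨ ⁅⁆≡insertAt a ⟩
      insertAt ⊥ a true                                  ≡⟨ cong (λ Z → insertAt Z a true) (preimage-⊥ (σ ⟨$⟩ʳ_)) ⟨
      insertAt (preimage (σ ⟨$⟩ʳ_) ⊥) a true             ≡⟨ preimage-insert a σ ⊥ true ⟩
      preimage (ρ ⟨$⟩ʳ_) (insertAt ⊥ (fromℕ n) true)     ≡⟨ cong (preimage (ρ ⟨$⟩ʳ_)) (⁅⁆≡insertAt (fromℕ n)) ⟨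
      preimage (ρ ⟨$⟩ʳ_) ⁅ fromℕ n ⁆                     ∎

contractᵇ : ∀ {n} → (Subset (suc n) → Bool) → Fin (suc n) → Subset n → Bool
contractᵇ p a X = if p ⁅ a ⁆ then p (insertAt X a true) else p (insertAt X a false)

contract-reflects : ∀ {n} (I : IndepSys (suc n)) p → (∀ U → I U ⇔ T (p U)) →
                    ∀ a X → contract I a X ⇔ T (contractᵇ p a X)
contract-reflects I p I⇔p a X with p ⁅ a ⁆ in eq
... | true = mk⇔
  (λ { (inj₁ (_ , i)) → to (I⇔p _) i
     ; (inj₂ (a-dep , _)) → contradiction (from (I⇔p ⁅ a ⁆) (subst T (sym eq) tt)) a-dep })
  (λ t → inj₁ (from (I⇔p ⁅ a ⁆) (subst T (sym eq) tt) , from (I⇔p _) t))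
... | false = mk⇔
  (λ { (inj₁ (a-indep , _)) → contradiction (to (I⇔p ⁅ a ⁆) a-indep) (subst T eq)
     ; (inj₂ (_ , i)) → to (I⇔p _) i })
  (λ t → inj₂ ((λ a-indep → subst T eq (to (I⇔p ⁅ a ⁆) a-indep)) , from (I⇔p _) t))

indepᵇ : Extension → Subset 8 → Bool
indepᵇ c = indepOfᵇ (isEmpty ∘ reduce c)

contractionᵇ : Extension → Subset 7 → Bool
contractionᵇ c = contractᵇ (indepᵇ c) 7F

contraction-of-F7*-extension : (N : Matroid 8) (a : Fin 8) → IsBinary N → (σ : Permutation 7 7) →
  (∀ Y → delete (indep N) a (preimage (σ ⟨$⟩ʳ_) Y) ⇔ F7* Y) →
  Σ Extension λ c → ∀ Y → contract (indep N) a (preimage (σ ⟨$⟩ʳ_) Y) ⇔ T (contractionᵇ c Y)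
contraction-of-F7*-extension N a (r , A , A-represents) σ N\a≅F7* = c , λ Y → begin
  contract (indep N) a (preimage (σ ⟨$⟩ʳ_) Y)   ≡⟨ contract-relabel (indep N) a σ Y ⟩
  contract N′ 7F Y                               ≈⟨ contract-reflects N′ (indepᵇ c) N′-indepᵇ 7F Y ⟩
  T (contractionᵇ c Y)                           ∎
  where
  open ⇔-Reasoning
  ρ = insert a 7F σ
  B = permuteColumns A ρ
  N′ : IndepSys 8
  N′ = indep N ∘ preimage (ρ ⟨$⟩ʳ_)
  N′-represented : ∀ U → N′ U ⇔ LinIndep B U
  N′-represented U = ⇔-trans (A-represents _) (linIndep-permuteColumns A ρ U)
  B-F7* : ∀ Y → LinIndep B (insertAt Y 7F false) ⇔ F7* Y
  B-F7* Y = begin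
    LinIndep B (insertAt Y 7F false)                  ≈⟨ N′-represented _ ⟨
    N′ (insertAt Y 7F false)                          ≡⟨ delete-relabel (indep N) a σ Y ⟨
    delete (indep N) a (preimage (σ ⟨$⟩ʳ_) Y)         ≈⟨ N\a≅F7* Y ⟩
    F7* Y                                             ∎
  open ExtensionOfF7* B B-F7* using (classify)
  c = proj₁ classify
  N′-indepᵇ : ∀ U → N′ U ⇔ T (indepᵇ c U)
  N′-indepᵇ U = ⇔-trans (N′-represented U) (proj₂ classify U)

-- Cycles and the incidence matrix

next-inject₁ : ∀ {k} (i : Fin k) → next {k} (inject₁ i) ≡ suc i
next-inject₁ {k} i with suc (toℕ (inject₁ i)) <? suc k
... | yes p = toℕ-injective (trans (toℕ-fromℕ< p) (cong suc (toℕ-inject₁ i)))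
... | no ¬p = contradiction (s≤s (subst (_< k) (sym (toℕ-inject₁ i)) (toℕ<n i))) ¬p

next-last : ∀ k → next {k} (fromℕ k) ≡ zero
next-last k with suc (toℕ (fromℕ k)) <? suc k
... | yes p = contradiction (subst (λ m → suc m < suc k) (toℕ-fromℕ k) p) (n≮n (suc k))
... | no _ = refl

sum-rotate : ∀ {k} (h : Fin (suc k) → Bool) → sum (h ∘ next) ≡ sum h
sum-rotate {k} h = begin
  sum (h ∘ next)                                    ≡⟨ sum-init-last (h ∘ next) ⟩
  sum (h ∘ next ∘ inject₁) xor h (next (fromℕ k))   ≡⟨ cong₂ _xor_ (sum-cong (cong h ∘ next-inject₁))
                                                                    (cong h (next-last k)) ⟩
  sum (h ∘ suc) xor h zero                          ≡⟨ xor-comm (sum (h ∘ suc)) (h zero) ⟩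
  sum h                                             ∎
  where open ≡-Reasoning

sum-telescope : ∀ {k} (h : Fin (suc k) → Bool) → sum (λ i → h i xor h (next i)) ≡ false
sum-telescope h = trans (∑-distrib-+ h (h ∘ next)) (trans (cong (sum h xor_) (sum-rotate h)) (xor-same (sum h)))

≟-true : ∀ {n} {x y : Fin n} → does (x ≟ y) ≡ true → x ≡ y
≟-true {x = x} {y} eq with x ≟ y
... | yes x≡y = x≡y

lookup-⁅⁆ : ∀ {n} (x w : Fin n) → lookup ⁅ x ⁆ w ≡ does (x ≟ w)
lookup-⁅⁆ x w = ⇔→≡ (mk⇔
  (λ w∈⁅x⁆ → dec-true (x ≟ w) (sym (x∈⁅y⁆⇒x≡y x (from ∈⇔lookup w∈⁅x⁆))))
  (λ x≟w → to ∈⇔lookup (subst (_∈ ⁅ x ⁆) (≟-true x≟w) (x∈⁅x⁆ x))))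

-- The parity of the number of preimages of w under f.
preimageCount : ∀ {m n} → (Fin m → Fin n) → Fin n → Bool
preimageCount f w = sum λ i → does (f i ≟ w)

preimageCount-absent : ∀ {m n} (f : Fin m → Fin n) {w} → (∀ i → f i ≢ w) → preimageCount f w ≡ false
preimageCount-absent f {w} f≢w = sum-zero (λ i → does (f i ≟ w)) λ i → dec-false (f i ≟ w) (f≢w i)

preimageCount-injective : ∀ {m n} (f : Fin m → Fin n) → Injective _≡_ _≡_ f → ∀ i₀ → preimageCount f (f i₀) ≡ true
preimageCount-injective f f-inj i₀ = begin
  sum (λ i → does (f i ≟ f i₀))        ≡⟨ sum-cong same ⟩
  sum (λ i → lookup ⁅ i₀ ⁆ i ∧ true)   ≡⟨ sumOver≡sum ⁅ i₀ ⁆ (λ _ → true) ⟨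
  sumOver ⁅ i₀ ⁆ (λ _ → true)          ≡⟨ sumOver-⁅⁆ i₀ (λ _ → true) ⟩
  true                                 ∎
  where
  open ≡-Reasoning
  same : ∀ i → does (f i ≟ f i₀) ≡ lookup ⁅ i₀ ⁆ i ∧ true
  same i = trans (⇔→≡ (mk⇔ (λ eq → dec-true (i₀ ≟ i) (sym (f-inj (≟-true eq))))
                           (λ eq → dec-true (f i ≟ f i₀) (cong f (sym (≟-true eq))))))
                 (sym (trans (∧-identityʳ _) (lookup-⁅⁆ i₀ i)))

sumOver-preimageCount : ∀ {m n} (f : Fin m → Fin n) g → sumOver (tabulate (preimageCount f)) g ≡ sum (g ∘ f)
sumOver-preimageCount {m} {n} f g = begin
  sumOver (tabulate (preimageCount f)) g          ≡⟨ sumOver≡sum (tabulate (preimageCount f)) g ⟩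
  sum (λ w → lookup (tabulate (preimageCount f)) w ∧ g w)
                                                  ≡⟨ sum-cong (λ w → cong (_∧ g w) (lookup∘tabulate (preimageCount f) w)) ⟩
  sum (λ w → preimageCount f w ∧ g w)             ≡⟨ sum-cong (λ w → *-distribʳ-sum (g w) (λ i → hit i w)) ⟩
  sum (λ w → sum λ i → hit i w ∧ g w)             ≡⟨ ∑-comm (λ w i → hit i w ∧ g w) ⟩
  sum (λ i → sum λ w → hit i w ∧ g w)             ≡⟨ sum-cong single ⟩
  sum (g ∘ f)                                     ∎
  where
  open ≡-Reasoning
  hit : Fin m → Fin n → Bool
  hit i w = does (f i ≟ w)
  single : ∀ i → sum (λ w → hit i w ∧ g w) ≡ g (f i)
  single i = begin
    sum (λ w → hit i w ∧ g w)                     ≡⟨ sum-cong (λ w → cong (_∧ g w) (lookup-⁅⁆ (f i) w)) ⟨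
    sum (λ w → lookup ⁅ f i ⁆ w ∧ g w)            ≡⟨ sumOver≡sum ⁅ f i ⁆ g ⟨
    sumOver ⁅ f i ⁆ g                             ≡⟨ sumOver-⁅⁆ (f i) g ⟩
    g (f i)                                       ∎

-- Over GF(2) a loop has incidence 1 + 1 = 0 with its vertex.
incidence : (G : Graph) → Fin (V G) → Fin (E G) → Bool
incidence G v e = does (v ≟ proj₁ (ends G e)) xor does (v ≟ proj₂ (ends G e))

incidence-joins : ∀ G {e x y} v → Joins G e x y → incidence G v e ≡ does (v ≟ x) xor does (v ≟ y)
incidence-joins G v (inj₁ refl) = refl
incidence-joins G {x = x} {y} v (inj₂ refl) = xor-comm (does (v ≟ y)) (does (v ≟ x))

module _ {G : Graph} {X : Subset (E G)} (c : CycleIn G X) where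

  open CycleIn c

  cycleEdges : Subset (E G)
  cycleEdges = tabulate (preimageCount es)

  cycleEdges-kernel : Kernel (incidence G) cycleEdges
  cycleEdges-kernel v = begin
    sumOver cycleEdges (incidence G v)          ≡⟨ sumOver-preimageCount es (incidence G v) ⟩
    sum (incidence G v ∘ es)                    ≡⟨ sum-cong (λ i → incidence-joins G v (es-joins i)) ⟩
    sum (λ i → does (v ≟ vs i) xor does (v ≟ vs (next i))) ≡⟨ sum-telescope (λ i → does (v ≟ vs i)) ⟩
    false                                       ∎
    where open ≡-Reasoning

  ∈-cycleEdges : ∀ i → es i ∈ cycleEdges
  ∈-cycleEdges i = from ∈⇔lookup
    (trans (lookup∘tabulate (preimageCount es) (es i)) (preimageCount-injective es es-inj i))

  cycleEdges-⊆ : cycleEdges ⊆ X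
  cycleEdges-⊆ {w} w∈ with any? (λ i → es i ≟ w)
  ... | yes (i , refl) = es-in i
  ... | no ∄i with () ← trans (sym (to ∈⇔lookup w∈))
                      (trans (lookup∘tabulate (preimageCount es) w) (preimageCount-absent es λ i eq → ∄i (i , eq)))

  cycle-avoiding : ∀ x → x ∉ cycleEdges → CycleIn G (X [ x ]≔ false)
  cycle-avoiding x x∉ = record
    { k = k ; vs = vs ; es = es ; vs-inj = vs-inj ; es-inj = es-inj ; es-joins = es-joins
    ; es-in = λ i → ∈-remove (λ { refl → x∉ (∈-cycleEdges i) }) (es-in i) }

cycle⇒¬linIndep : ∀ {G X} → CycleIn G X → ¬ LinIndep (incidence G) X
cycle⇒¬linIndep c indep =
  ∉⊥ (subst (CycleIn.es c zero ∈_) (indep (cycleEdges c) (cycleEdges-⊆ c) (cycleEdges-kernel c)) (∈-cycleEdges c zero))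

kernel-graphCircuit : ∀ {G X} → ¬ ¬ CycleIn G X → (∀ x → x ∈ X → ¬ CycleIn G (X [ x ]≔ false)) →
                      Kernel (incidence G) X
kernel-graphCircuit {G} {X} ¬¬cycle minimal = decidable-stable (kernel? (incidence G) X) λ X∉ker →
  ¬¬cycle λ c → X∉ker (subst (Kernel (incidence G)) (⊆-antisym (cycleEdges-⊆ c) (X⊆ c)) (cycleEdges-kernel c))
  where
  X⊆ : (c : CycleIn G X) → X ⊆ cycleEdges c
  X⊆ c {x} x∈X = decidable-stable (x ∈? cycleEdges c) λ x∉ → minimal x x∈X (cycle-avoiding c x x∉)

graph : ∀ {V m} → (Fin m → Fin V × Fin V) → Graph
graph {V} {m} ends = record { V = V ; E = m ; ends = ends }

relabel : ∀ {m} (G : Graph) → (Fin m → Fin (E G)) → Graph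
relabel G f = graph (ends G ∘ f)

cycle-relabel : ∀ {m} (G : Graph) (θ : Fin m ↔ Fin (E G)) Y →
                CycleIn G Y ⇔ CycleIn (relabel G (θ ⟨$⟩ʳ_)) (preimage (θ ⟨$⟩ʳ_) Y)
cycle-relabel G θ Y = mk⇔ ⇒ ⇐
  where
  ⇒ : CycleIn G Y → CycleIn (relabel G (θ ⟨$⟩ʳ_)) (preimage (θ ⟨$⟩ʳ_) Y)
  ⇒ c = record
    { k = k ; vs = vs ; es = (θ ⟨$⟩ˡ_) ∘ es ; vs-inj = vs-inj
    ; es-inj = λ eq → es-inj (trans (sym (inverseʳ θ)) (trans (cong (θ ⟨$⟩ʳ_) eq) (inverseʳ θ)))
    ; es-in = λ i → from ∈⇔lookup (trans (lookup-preimage (θ ⟨$⟩ʳ_) Y _)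
                     (trans (cong (lookup Y) (inverseʳ θ)) (to ∈⇔lookup (es-in i))))
    ; es-joins = λ i → subst (λ e → Joins G e (vs i) (vs (next i))) (sym (inverseʳ θ)) (es-joins i) }
    where open CycleIn c
  ⇐ : CycleIn (relabel G (θ ⟨$⟩ʳ_)) (preimage (θ ⟨$⟩ʳ_) Y) → CycleIn G Y
  ⇐ c = record
    { k = k ; vs = vs ; es = (θ ⟨$⟩ʳ_) ∘ es ; vs-inj = vs-inj ; es-joins = es-joins
    ; es-inj = λ eq → es-inj (trans (sym (inverseˡ θ)) (trans (cong (θ ⟨$⟩ˡ_) eq) (inverseˡ θ)))
    ; es-in = λ i → from ∈⇔lookup (trans (sym (lookup-preimage (θ ⟨$⟩ʳ_) Y (es i))) (to ∈⇔lookup (es-in i)))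
    }
    where open CycleIn c

≅-cycleMatroid : ∀ {n} {I : IndepSys n} {G} → I ≅ CycleMatroid G →
                 Σ (Fin n → Fin (V G) × Fin (V G)) λ ends′ → ∀ X → I X ⇔ CycleMatroid (graph ends′) X
≅-cycleMatroid {n} {I} {G} (τ , I≅G) = ends G ∘ (τ ⟨$⟩ʳ_) , λ X → begin
  I X                                          ≡⟨ cong I (τ∘τ⁻¹ X) ⟨
  I (preimage (τ ⟨$⟩ʳ_) (τ⁻¹ X))               ≈⟨ I≅G (τ⁻¹ X) ⟩
  CycleMatroid G (τ⁻¹ X)                       ≈⟨ ¬-cong-⇔ (cycle-relabel G τ (τ⁻¹ X)) ⟩
  CycleMatroid G′ (preimage (τ ⟨$⟩ʳ_) (τ⁻¹ X)) ≡⟨ cong (CycleMatroid G′) (τ∘τ⁻¹ X) ⟩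
  CycleMatroid G′ X                            ∎
  where
  open ⇔-Reasoning
  G′ = relabel G (τ ⟨$⟩ʳ_)
  τ⁻¹ : Subset n → Subset (E G)
  τ⁻¹ = preimage (τ ⟨$⟩ˡ_)
  τ∘τ⁻¹ : ∀ X → preimage (τ ⟨$⟩ʳ_) (τ⁻¹ X) ≡ X
  τ∘τ⁻¹ = preimage-inverse (τ ⟨$⟩ʳ_) (τ ⟨$⟩ˡ_) (λ _ → inverseˡ τ)

injective₂ : ∀ {A : Set} (f : Fin 2 → A) → f 0F ≢ f 1F → Injective _≡_ _≡_ f
injective₂ f f₀≢f₁ {0F} {0F} _ = refl
injective₂ f f₀≢f₁ {0F} {1F} eq = contradiction eq f₀≢f₁
injective₂ f f₀≢f₁ {1F} {0F} eq = contradiction (sym eq) f₀≢f₁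
injective₂ f f₀≢f₁ {1F} {1F} _ = refl

injective₃ : ∀ {A : Set} (f : Fin 3 → A) → f 0F ≢ f 1F → f 1F ≢ f 2F → f 2F ≢ f 0F →
             Injective _≡_ _≡_ f
injective₃ f ≢₀₁ ≢₁₂ ≢₂₀ {i} {j} eq with i | j
... | 0F | 0F = refl
... | 0F | 1F = contradiction eq ≢₀₁
... | 0F | 2F = contradiction (sym eq) ≢₂₀
... | 1F | 0F = contradiction (sym eq) ≢₀₁
... | 1F | 1F = refl
... | 1F | 2F = contradiction eq ≢₁₂
... | 2F | 0F = contradiction eq ≢₂₀
... | 2F | 1F = contradiction (sym eq) ≢₁₂
... | 2F | 2F = refl

module _ {G : Graph} {X : Subset (E G)} where

  loop-cycle : ∀ {e x} → ends G e ≡ (x , x) → e ∈ X → CycleIn G X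
  loop-cycle {e} {x} loop e∈X = record
    { k = 0 ; vs = λ _ → x ; es = λ _ → e
    ; vs-inj = λ { {0F} {0F} _ → refl } ; es-inj = λ { {0F} {0F} _ → refl }
    ; es-in = λ { 0F → e∈X } ; es-joins = λ { 0F → inj₁ loop } }

  digon-cycle : ∀ {e f x y} → x ≢ y → e ≢ f → Joins G e x y → Joins G f y x → e ∈ X → f ∈ X →
                CycleIn G X
  digon-cycle {e} {f} {x} {y} x≢y e≢f e-joins f-joins e∈X f∈X = record
    { k = 1 ; vs = vs ; es = es ; vs-inj = injective₂ vs x≢y ; es-inj = injective₂ es e≢f
    ; es-in = λ { 0F → e∈X ; 1F → f∈X } ; es-joins = λ { 0F → e-joins ; 1F → f-joins } }
    where
    vs : Fin 2 → Fin (V G)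
    vs 0F = x
    vs 1F = y
    es : Fin 2 → Fin (E G)
    es 0F = e
    es 1F = f

  triangle-cycle : ∀ {e f g x y z} → x ≢ y → y ≢ z → z ≢ x → e ≢ f → f ≢ g → g ≢ e →
                   Joins G e x y → Joins G f y z → Joins G g z x → e ∈ X → f ∈ X → g ∈ X → CycleIn G X
  triangle-cycle {e} {f} {g} {x} {y} {z} x≢y y≢z z≢x e≢f f≢g g≢e e-joins f-joins g-joins e∈X f∈X g∈X = record
    { k = 2 ; vs = vs ; es = es
    ; vs-inj = injective₃ vs x≢y y≢z z≢x ; es-inj = injective₃ es e≢f f≢g g≢e
    ; es-in = λ { 0F → e∈X ; 1F → f∈X ; 2F → g∈X }
    ; es-joins = λ { 0F → e-joins ; 1F → f-joins ; 2F → g-joins }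
    }
    where
    vs : Fin 3 → Fin (V G)
    vs 0F = x
    vs 1F = y
    vs 2F = z
    es : Fin 3 → Fin (E G)
    es 0F = e
    es 1F = f
    es 2F = g

-- Neither F7* nor F7 is graphic

setOf : ∀ {n} → List (Fin n) → Subset n
setOf [] = ⊥
setOf (x ∷ xs) = ⁅ x ⁆ ∪ setOf xs

∈-setOf : ∀ {n} {x : Fin n} xs → x ∈ₗ xs → x ∈ setOf xs
∈-setOf (x ∷ xs) (hereₗ refl) = x∈p∪q⁺ (inj₁ (x∈⁅x⁆ x))
∈-setOf (_ ∷ xs) (thereₗ x∈xs) = x∈p∪q⁺ (inj₂ (∈-setOf xs x∈xs))

-- s is orthogonal to every set in CS; for the circuits of M, s is then a cocycle of M.
cocycleᵇ : ∀ {n} → List (Subset n) → Subset n → Bool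
cocycleᵇ CS s = all (λ C → not (sumOver C (lookup s))) CS

meetsOnlyAtᵇ : ∀ {n} → Fin n → Subset n → Subset n → Bool
meetsOnlyAtᵇ {n} j s t = every n λ i → (lookup s i ∧ lookup t i) ⇒ᵇ does (i ≟ j)

F7*-circuits F7-circuits : List (Subset 7)
F7*-circuits = setOf (0F ∷ 1F ∷ 2F ∷ 6F ∷ []) ∷ setOf (0F ∷ 1F ∷ 4F ∷ 5F ∷ [])
             ∷ setOf (0F ∷ 2F ∷ 3F ∷ 5F ∷ []) ∷ setOf (0F ∷ 3F ∷ 4F ∷ 6F ∷ [])
             ∷ setOf (1F ∷ 2F ∷ 3F ∷ 4F ∷ []) ∷ setOf (1F ∷ 3F ∷ 5F ∷ 6F ∷ [])
             ∷ setOf (2F ∷ 4F ∷ 5F ∷ 6F ∷ []) ∷ []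
F7-circuits = setOf (0F ∷ 1F ∷ 3F ∷ []) ∷ setOf (0F ∷ 2F ∷ 4F ∷ []) ∷ setOf (0F ∷ 5F ∷ 6F ∷ [])
            ∷ setOf (1F ∷ 2F ∷ 5F ∷ []) ∷ setOf (1F ∷ 4F ∷ 6F ∷ []) ∷ setOf (2F ∷ 3F ∷ 6F ∷ [])
            ∷ setOf (3F ∷ 4F ∷ 5F ∷ []) ∷ []

-- Read with s, t, w the stars of the ends x, y of edge 6 and of the far end u of an edge j ∈ s − t:
-- then k closes the triangle 6 k j.  Checked exhaustively.
F7*-cocycles : ∀ s t → T (cocycleᵇ F7*-circuits s) → T (lookup s 6F) →
               T (cocycleᵇ F7*-circuits t) → T (lookup t 6F) → T (meetsOnlyAtᵇ 6F s t) →
               ∃[ j ] T (lookup s j) × T (not (lookup t j)) ×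
                 (∀ w → T (cocycleᵇ F7*-circuits w) → T (lookup w j) → T (not (lookup w 6F)) →
                  T (meetsOnlyAtᵇ j w s) → ∃[ k ] T (lookup w k) × T (lookup t k))
F7*-cocycles s t cs s∋6 ct t∋6 s∩t=6 =
  let all-t = ⇒ᵇ-elim (everySubset-sound 7 sOk checked s) (cs ,ᵇ s∋6)
      j , j-ok = some-sound 7 (jOk s t) (⇒ᵇ-elim (everySubset-sound 7 (tOk s) all-t t) (ct ,ᵇ t∋6 ,ᵇ s∩t=6))
      j∈s , j∉t , all-w = T-∧₃ {lookup s j} j-ok
  in j , j∈s , j∉t , λ w cw j∈w w∌6 w∩s=j →
       let k , k-ok = some-sound 7 (λ k → lookup w k ∧ lookup t k)
                        (⇒ᵇ-elim (everySubset-sound 7 (wOk s t j) all-w w) (cw ,ᵇ j∈w ,ᵇ w∌6 ,ᵇ w∩s=j))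
       in k , to T-∧ k-ok
  where
  CS = F7*-circuits
  wOk : Subset 7 → Subset 7 → Fin 7 → Subset 7 → Bool
  wOk s t j w = (cocycleᵇ CS w ∧ lookup w j ∧ not (lookup w 6F) ∧ meetsOnlyAtᵇ j w s) ⇒ᵇ
                some 7 λ k → lookup w k ∧ lookup t k
  jOk : Subset 7 → Subset 7 → Fin 7 → Bool
  jOk s t j = lookup s j ∧ not (lookup t j) ∧ everySubset 7 (wOk s t j)
  tOk : Subset 7 → Subset 7 → Bool
  tOk s t = (cocycleᵇ CS t ∧ lookup t 6F ∧ meetsOnlyAtᵇ 6F s t) ⇒ᵇ some 7 (jOk s t)
  sOk : Subset 7 → Bool
  sOk s = (cocycleᵇ CS s ∧ lookup s 6F) ⇒ᵇ everySubset 7 (tOk s)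
  checked : T (everySubset 7 sOk)
  checked = tt

-- The stars of the two ends of edge 0 share a further edge, parallel to 0.  Checked exhaustively.
F7-cocycles : ∀ s t → T (cocycleᵇ F7-circuits s) → T (lookup s 0F) →
              T (cocycleᵇ F7-circuits t) → T (lookup t 0F) →
              ∃[ j ] j ≢ 0F × T (lookup s j) × T (lookup t j)
F7-cocycles s t cs s∋0 ct t∋0 =
  let all-t = ⇒ᵇ-elim (everySubset-sound 7 sOk checked s) (cs ,ᵇ s∋0)
      j , j-ok = some-sound 7 (jOk s t) (⇒ᵇ-elim (everySubset-sound 7 (tOk s) all-t t) (ct ,ᵇ t∋0))
      j≠0 , j∈s , j∈t = T-∧₃ {not (does (j ≟ 0F))} j-ok
  in j , (λ j≡0 → subst T (to T-not-≡ j≠0) (from T-≡ (dec-true (j ≟ 0F) j≡0))) , j∈s , j∈t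
  where
  CS = F7-circuits
  jOk : Subset 7 → Subset 7 → Fin 7 → Bool
  jOk s t j = not (does (j ≟ 0F)) ∧ lookup s j ∧ lookup t j
  tOk : Subset 7 → Subset 7 → Bool
  tOk s t = (cocycleᵇ CS t ∧ lookup t 0F) ⇒ᵇ some 7 (jOk s t)
  sOk : Subset 7 → Bool
  sOk s = (cocycleᵇ CS s ∧ lookup s 0F) ⇒ᵇ everySubset 7 (tOk s)
  checked : T (everySubset 7 sOk)
  checked = tt

flip-joins : ∀ {G e x y} → Joins G e x y → Joins G e y x
flip-joins (inj₁ eq) = inj₂ eq
flip-joins (inj₂ eq) = inj₁ eq

distinct-by : ∀ {n} (s : Subset n) {a b} → T (lookup s a) → T (not (lookup s b)) → a ≢ b
distinct-by s a∈s b∉s refl = subst T (to T-not-≡ b∉s) a∈s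

module GraphicRepresentation {V} (ends : Fin 7 → Fin V × Fin V) (ind : Subset 7 → Bool)
  (represents : ∀ X → T (ind X) ⇔ CycleMatroid (graph ends) X)
  (pairs-indep : ∀ i j → T (ind (setOf (i ∷ j ∷ [])))) where

  G : Graph
  G = graph ends

  no-loop : ∀ {j x} → ¬ Joins G j x x
  no-loop {j} loop =
    to (represents _) (pairs-indep j j) (loop-cycle {G} {e = j} ([ id , id ]′ loop) (∈-setOf (j ∷ j ∷ []) (hereₗ refl)))

  joins-distinct : ∀ {e x y} → Joins G e x y → x ≢ y
  joins-distinct e-joins refl = no-loop e-joins

  no-parallel : ∀ {i j x y} → i ≢ j → Joins G i x y → Joins G j x y → Empty
  no-parallel {i} {j} i≢j i-joins j-joins = to (represents _) (pairs-indep i j)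
    (digon-cycle (joins-distinct i-joins) i≢j i-joins (flip-joins {G} j-joins)
                 (∈-setOf (i ∷ j ∷ []) (hereₗ refl)) (∈-setOf (i ∷ j ∷ []) (thereₗ (hereₗ refl))))

  incidence-end : ∀ {e x y} → Joins G e x y → incidence G x e ≡ true
  incidence-end {x = x} {y} e-joins =
    trans (incidence-joins G x e-joins)
          (cong₂ _xor_ (dec-true (x ≟ x) refl) (dec-false (x ≟ y) (joins-distinct e-joins)))

  incidence-off : ∀ {e x y v} → v ≢ x → v ≢ y → Joins G e x y → incidence G v e ≡ false
  incidence-off {x = x} {y} {v} v≢x v≢y e-joins =
    trans (incidence-joins G v e-joins) (cong₂ _xor_ (dec-false (v ≟ x) v≢x) (dec-false (v ≟ y) v≢y))

  other-end : ∀ {e x} → incidence G x e ≡ true → ∃[ u ] Joins G e x u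
  other-end {e} {x} x∈e with x ≟ proj₁ (ends e) | x ≟ proj₂ (ends e)
  ... | yes refl | _ = proj₂ (ends e) , inj₁ refl
  ... | no _ | yes refl = proj₁ (ends e) , inj₂ refl
  ... | no _ | no _ = contradiction x∈e λ ()

  joins-of-incidence : ∀ {e x y} → x ≢ y → incidence G x e ≡ true → incidence G y e ≡ true →
                       Joins G e x y
  joins-of-incidence {e} {x} {y} x≢y x∈e y∈e with other-end x∈e
  ... | u , e-joins with y ≟ u
  ...   | yes refl = e-joins
  ...   | no y≢u = contradiction (trans (sym y∈e) (incidence-off (x≢y ∘ sym) y≢u e-joins)) λ ()

  star : Fin V → Subset 7
  star v = tabulate (incidence G v)

  T-star : ∀ v j → T (lookup (star v) j) ⇔ incidence G v j ≡ true
  T-star v j = mk⇔ (λ t → trans (sym (lookup∘tabulate (incidence G v) j)) (to T-≡ t))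
                       (λ eq → from T-≡ (trans (lookup∘tabulate (incidence G v) j) eq))

  stars-meet-only-at : ∀ {e x y} → Joins G e x y → T (meetsOnlyAtᵇ e (star x) (star y))
  stars-meet-only-at {e} {x} {y} e-joins = every-complete 7 _ only-e
    where
    only-e : ∀ i → T ((lookup (star x) i ∧ lookup (star y) i) ⇒ᵇ does (i ≟ e))
    only-e i with lookup (star x) i in x∈i | lookup (star y) i in y∈i | i ≟ e
    ... | true | true | no i≢e = no-parallel i≢e
            (joins-of-incidence (joins-distinct e-joins) (to (T-star x i) (from T-≡ x∈i))
                                (to (T-star y i) (from T-≡ y∈i)))
            e-joins
    ... | true | true | yes _ = tt
    ... | true | false | _ = tt
    ... | false | _ | _ = tt

  circuit-kernel : ∀ C → T (isCircuitᵇ ind C) → Kernel (incidence G) C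
  circuit-kernel C isC with to (T-∧ {not (ind C)}) isC
  ... | dependent , minimal = kernel-graphCircuit
    (λ no-cycle → subst T (to T-not-≡ dependent) (from (represents C) no-cycle))
    (λ x x∈C → to (represents _)
       (⇒ᵇ-elim (every-sound 7 (λ x → lookup C x ⇒ᵇ ind (C [ x ]≔ false)) minimal x) (from T-≡ (to ∈⇔lookup x∈C))))

  stars-cocycles : ∀ CS → T (all (isCircuitᵇ ind) CS) → ∀ v → T (cocycleᵇ CS (star v))
  stars-cocycles CS circuits v = all⁻ _ (All.map orthogonal (all⁺ (isCircuitᵇ ind) CS circuits))
    where
    orthogonal : ∀ {C} → T (isCircuitᵇ ind C) → T (not (sumOver C (lookup (star v))))
    orthogonal {C} isC = from T-not-≡ (begin
      sumOver C (lookup (star v))          ≡⟨ sumOver-cong C (lookup∘tabulate (incidence G v)) ⟩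
      sumOver C (incidence G v)            ≡⟨ circuit-kernel C isC v ⟩
      false                                ∎)
      where open ≡-Reasoning

  ∈-star : ∀ {e x y} → Joins G e x y → T (lookup (star x) e)
  ∈-star {e} {x} e-joins = from (T-star x e) (incidence-end e-joins)

  ∉-star : ∀ {e x y v} → v ≢ x → v ≢ y → Joins G e x y → T (not (lookup (star v) e))
  ∉-star {e} {v = v} v≢x v≢y e-joins =
    from T-not-≡ (trans (lookup∘tabulate (incidence G v) e) (incidence-off v≢x v≢y e-joins))

  third-end : ∀ {e j x y} → Joins G e x y → T (lookup (star x) j) → T (not (lookup (star y) j)) →
              ∃[ u ] Joins G j x u × u ≢ x × u ≢ y
  third-end {e} {j} {x} e-joins j∈x j∉y with other-end (to (T-star x j) j∈x)
  ... | u , j-joins = u , j-joins , joins-distinct j-joins ∘ sym ,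
                      λ { refl → subst T (to T-not-≡ j∉y) (∈-star (flip-joins {G} j-joins)) }

  no-triangle : (∀ i j k → T (ind (setOf (i ∷ j ∷ k ∷ [])))) → ∀ {e f g x y z} → e ≢ f → f ≢ g → g ≢ e →
                Joins G e x y → Joins G f y z → Joins G g z x → Empty
  no-triangle triples-indep {e} {f} {g} e≢f f≢g g≢e e-joins f-joins g-joins = to (represents _) (triples-indep e f g)
    (triangle-cycle (joins-distinct e-joins) (joins-distinct f-joins) (joins-distinct g-joins) e≢f f≢g g≢e
       e-joins f-joins g-joins
       (∈-setOf (e ∷ f ∷ g ∷ []) (hereₗ refl)) (∈-setOf (e ∷ f ∷ g ∷ []) (thereₗ (hereₗ refl)))
       (∈-setOf (e ∷ f ∷ g ∷ []) (thereₗ (thereₗ (hereₗ refl)))))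

  F7*-not-graphic : T (all (isCircuitᵇ ind) F7*-circuits) → (∀ i j k → T (ind (setOf (i ∷ j ∷ k ∷ [])))) →
                    Empty
  F7*-not-graphic circuits triples-indep = triangle-at (inj₁ refl)
    where
    triangle-at : ∀ {x y} → Joins G 6F x y → Empty
    triangle-at {x} {y} 6-joins =
      case F7*-cocycles (star x) (star y) (stars-cocycles F7*-circuits circuits x) (∈-star 6-joins)
                        (stars-cocycles F7*-circuits circuits y) (∈-star (flip-joins {G} 6-joins))
                        (stars-meet-only-at 6-joins) of λ where
      (j , j∈x , j∉y , meets-y) → case third-end {j = j} 6-joins j∈x j∉y of λ where
        (u , j-joins , u≢x , u≢y) →
          case meets-y (star u) (stars-cocycles F7*-circuits circuits u) (∈-star (flip-joins {G} j-joins))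
                       (∉-star u≢x u≢y 6-joins) (stars-meet-only-at (flip-joins {G} j-joins)) of λ where
          (k , k∈u , k∈y) → no-triangle triples-indep
            (distinct-by (star u) k∈u (∉-star u≢x u≢y 6-joins) ∘ sym)
            (distinct-by (star y) k∈y j∉y)
            (distinct-by (star y) (∈-star (flip-joins {G} 6-joins)) j∉y ∘ sym)
            6-joins (joins-of-incidence (u≢y ∘ sym) (to (T-star y k) k∈y) (to (T-star u k) k∈u))
            (flip-joins {G} j-joins)

  F7-not-graphic : T (all (isCircuitᵇ ind) F7-circuits) → Empty
  F7-not-graphic circuits = parallel-at (inj₁ refl)
    where
    parallel-at : ∀ {x y} → Joins G 0F x y → Empty
    parallel-at {x} {y} 0-joins =
      case F7-cocycles (star x) (star y) (stars-cocycles F7-circuits circuits x) (∈-star 0-joins)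
                       (stars-cocycles F7-circuits circuits y) (∈-star (flip-joins {G} 0-joins)) of λ where
      (j , j≢0 , j∈x , j∈y) →
        no-parallel j≢0 (joins-of-incidence (joins-distinct 0-joins) (to (T-star x j) j∈x) (to (T-star y j) j∈y)) 0-joins

-- Recognising M(G₁₀) and M(G₁₁)

joinsᵇ : (G : Graph) → Fin (E G) → Fin (V G) → Fin (V G) → Bool
joinsᵇ G e x y = (does (proj₁ (ends G e) ≟ x) ∧ does (proj₂ (ends G e) ≟ y))
               ∨ (does (proj₁ (ends G e) ≟ y) ∧ does (proj₂ (ends G e) ≟ x))

joinsᵇ-sound : ∀ G e x y → T (joinsᵇ G e x y) → Joins G e x y
joinsᵇ-sound G e x y t = case to (T-∨ {does (p ≟ x) ∧ does (q ≟ y)}) t of λ where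
    (inj₁ t₁) → inj₁ (ends≡ (to (T-∧ {does (p ≟ x)}) t₁))
    (inj₂ t₂) → inj₂ (ends≡ (to (T-∧ {does (p ≟ y)}) t₂))
  where
  p = proj₁ (ends G e)
  q = proj₂ (ends G e)
  ends≡ : ∀ {u w} → T (does (p ≟ u)) × T (does (q ≟ w)) → ends G e ≡ (u , w)
  ends≡ (p≡u , q≡w) = cong₂ _,_ (≟-true (to T-≡ p≡u)) (≟-true (to T-≡ q≡w))

injectiveᵇ : ∀ {m n} → (Fin m → Fin n) → Bool
injectiveᵇ {m} f = every m λ i → every m λ j → does (f i ≟ f j) ⇒ᵇ does (i ≟ j)

injectiveᵇ-sound : ∀ {m n} (f : Fin m → Fin n) → T (injectiveᵇ f) → Injective _≡_ _≡_ f
injectiveᵇ-sound {m} f t {i} {j} fi≡fj = ≟-true (to T-≡ (⇒ᵇ-elim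
  (every²-sound m m (λ i j → does (f i ≟ f j) ⇒ᵇ does (i ≟ j)) t i j) (from T-≡ (dec-true (f i ≟ f j) fi≡fj))))

cycleᵇ : (G : Graph) → Subset (E G) → ∀ k → (Fin (suc k) → Fin (V G)) → (Fin (suc k) → Fin (E G)) → Bool
cycleᵇ G X k vs es = injectiveᵇ vs ∧ injectiveᵇ es ∧
                     every (suc k) λ i → joinsᵇ G (es i) (vs i) (vs (next i)) ∧ lookup X (es i)

cycleᵇ-sound : ∀ G X k vs es → T (cycleᵇ G X k vs es) → CycleIn G X
cycleᵇ-sound G X k vs es t = record
  { k = k ; vs = vs ; es = es ; vs-inj = injectiveᵇ-sound vs vs-inj ; es-inj = injectiveᵇ-sound es es-inj
  ; es-in = λ i → from ∈⇔lookup (to T-≡ (proj₂ (edge i)))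
  ; es-joins = λ i → joinsᵇ-sound G (es i) (vs i) (vs (next i)) (proj₁ (edge i))
  }
  where
  vs-inj = proj₁ (T-∧₃ {injectiveᵇ vs} {injectiveᵇ es} t)
  es-inj = proj₁ (proj₂ (T-∧₃ {injectiveᵇ vs} {injectiveᵇ es} t))
  edge : ∀ i → T (joinsᵇ G (es i) (vs i) (vs (next i))) × T (lookup X (es i))
  edge i = to T-∧ (every-sound (suc k) (λ i → joinsᵇ G (es i) (vs i) (vs (next i)) ∧ lookup X (es i))
                                (proj₂ (proj₂ (T-∧₃ {injectiveᵇ vs} {injectiveᵇ es} t))) i)

cycle-mono : ∀ {G C Y} → C ⊆ Y → CycleIn G C → CycleIn G Y
cycle-mono C⊆Y c = record { CycleIn c ; es-in = C⊆Y ∘ CycleIn.es-in c }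

-- The edge set of a cycle is dependent over the incidence matrix, so the first check rules out cycles
-- in independent sets; the second exhibits a cycle in every dependent set.
cycleMatroid-by-check : (G : Graph) (ind : Subset (E G) → Bool) (cycles : List (Σ (Subset (E G)) (CycleIn G))) →
  T (everySubset (E G) λ Y → ind Y ⇒ᵇ indepOfᵇ (kernelᵇ (incidence G)) Y) →
  T (everySubset (E G) λ Y → ind Y ∨ any (λ C → isYes (proj₁ C ⊆? Y)) cycles) →
  ∀ Y → T (ind Y) ⇔ CycleMatroid G Y
cycleMatroid-by-check G ind cycles free-check cover-check Y = mk⇔
  (λ t c → cycle⇒¬linIndep c (to (T-linIndepᵇ (incidence G) Y)
           (⇒ᵇ-elim (everySubset-sound (E G) free free-check Y) t)))
  (λ no-cycle → case to (T-∨ {ind Y}) (everySubset-sound (E G) cover cover-check Y) of λ where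
     (inj₁ t) → t
     (inj₂ t) → let (C , c) , C⊆Y = satisfied (any⁻ (λ C → isYes (proj₁ C ⊆? Y)) cycles t)
                in contradiction (cycle-mono (toWitness C⊆Y) c) no-cycle)
  where
  free cover : Subset (E G) → Bool
  free Y = ind Y ⇒ᵇ indepOfᵇ (kernelᵇ (incidence G)) Y
  cover Y = ind Y ∨ any (λ C → isYes (proj₁ C ⊆? Y)) cycles

cycleOf : (G : Graph) {k : ℕ} (vs : Vec (Fin (V G)) (suc k)) (es : Vec (Fin (E G)) (suc k)) →
          T (cycleᵇ G (setOf (toList es)) k (lookup vs) (lookup es)) → Σ (Subset (E G)) (CycleIn G)
cycleOf G {k} vs es t = setOf (toList es) , cycleᵇ-sound G (setOf (toList es)) k (lookup vs) (lookup es) t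

G₁₀-cycles : List (Σ (Subset 7) (CycleIn G₁₀))
G₁₀-cycles = cycleOf G₁₀ (0F ∷ []) (6F ∷ []) tt
           ∷ cycleOf G₁₀ (0F ∷ 1F ∷ 2F ∷ []) (0F ∷ 3F ∷ 1F ∷ []) tt
           ∷ cycleOf G₁₀ (0F ∷ 1F ∷ 3F ∷ []) (0F ∷ 4F ∷ 2F ∷ []) tt
           ∷ cycleOf G₁₀ (0F ∷ 2F ∷ 3F ∷ []) (1F ∷ 5F ∷ 2F ∷ []) tt
           ∷ cycleOf G₁₀ (1F ∷ 2F ∷ 3F ∷ []) (3F ∷ 5F ∷ 4F ∷ []) tt
           ∷ cycleOf G₁₀ (0F ∷ 1F ∷ 2F ∷ 3F ∷ []) (0F ∷ 3F ∷ 5F ∷ 2F ∷ []) tt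
           ∷ cycleOf G₁₀ (0F ∷ 1F ∷ 3F ∷ 2F ∷ []) (0F ∷ 4F ∷ 5F ∷ 1F ∷ []) tt
           ∷ cycleOf G₁₀ (0F ∷ 2F ∷ 1F ∷ 3F ∷ []) (1F ∷ 3F ∷ 4F ∷ 2F ∷ []) tt
           ∷ []

G₁₁-cycles : List (Σ (Subset 7) (CycleIn G₁₁))
G₁₁-cycles = cycleOf G₁₁ (0F ∷ 1F ∷ []) (0F ∷ 1F ∷ []) tt
           ∷ cycleOf G₁₁ (1F ∷ 2F ∷ []) (2F ∷ 3F ∷ []) tt
           ∷ cycleOf G₁₁ (2F ∷ 3F ∷ []) (4F ∷ 5F ∷ []) tt
           ∷ cycleOf G₁₁ (0F ∷ 1F ∷ 2F ∷ 3F ∷ []) (0F ∷ 2F ∷ 4F ∷ 6F ∷ []) tt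
           ∷ cycleOf G₁₁ (0F ∷ 1F ∷ 2F ∷ 3F ∷ []) (0F ∷ 2F ∷ 5F ∷ 6F ∷ []) tt
           ∷ cycleOf G₁₁ (0F ∷ 1F ∷ 2F ∷ 3F ∷ []) (0F ∷ 3F ∷ 4F ∷ 6F ∷ []) tt
           ∷ cycleOf G₁₁ (0F ∷ 1F ∷ 2F ∷ 3F ∷ []) (0F ∷ 3F ∷ 5F ∷ 6F ∷ []) tt
           ∷ cycleOf G₁₁ (0F ∷ 1F ∷ 2F ∷ 3F ∷ []) (1F ∷ 2F ∷ 4F ∷ 6F ∷ []) tt
           ∷ cycleOf G₁₁ (0F ∷ 1F ∷ 2F ∷ 3F ∷ []) (1F ∷ 2F ∷ 5F ∷ 6F ∷ []) tt
           ∷ cycleOf G₁₁ (0F ∷ 1F ∷ 2F ∷ 3F ∷ []) (1F ∷ 3F ∷ 4F ∷ 6F ∷ []) tt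
           ∷ cycleOf G₁₁ (0F ∷ 1F ∷ 2F ∷ 3F ∷ []) (1F ∷ 3F ∷ 5F ∷ 6F ∷ []) tt
           ∷ []

firstWhere : ∀ {n} → (Fin (suc n) → Bool) → Fin (suc n)
firstWhere {zero} p = zero
firstWhere {suc n} p = if p zero then zero else suc (firstWhere (p ∘ suc))

searchInverse : ∀ {n} → (Fin (suc n) → Fin (suc n)) → Fin (suc n) → Fin (suc n)
searchInverse f j = firstWhere λ i → does (f i ≟ j)

invertibleᵇ : ∀ {n} → (Fin (suc n) → Fin (suc n)) → Bool
invertibleᵇ {n} f = every (suc n) λ i → does (f (searchInverse f i) ≟ i) ∧ does (searchInverse f (f i) ≟ i)

permutation : ∀ {n} (f : Fin (suc n) → Fin (suc n)) → T (invertibleᵇ f) → Permutation (suc n) (suc n)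
permutation {n} f invertible = mk↔ₛ′ f (searchInverse f)
  (λ i → ≟-true (to T-≡ (proj₁ (inverse i)))) (λ i → ≟-true (to T-≡ (proj₂ (inverse i))))
  where
  inverse : ∀ i → T (does (f (searchInverse f i) ≟ i)) × T (does (searchInverse f (f i) ≟ i))
  inverse i = to T-∧
    (every-sound (suc n) (λ i → does (f (searchInverse f i) ≟ i) ∧ does (searchInverse f (f i) ≟ i))
                 invertible i)

open GraphicRepresentation using (F7*-not-graphic; F7-not-graphic)

module _ (I : IndepSys 7) (σ : Permutation 7 7) (c : Extension)
         (I≈c : ∀ Y → I (preimage (σ ⟨$⟩ʳ_) Y) ⇔ T (contractionᵇ c Y)) where

  isomorphic-by-check : ∀ H (π : Fin 7 ↔ Fin (E H)) (cycles : List (Σ (Subset (E H)) (CycleIn H))) →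
    let ind = contractionᵇ c ∘ preimage (π ⟨$⟩ʳ_) in
    T (everySubset (E H) λ Y → ind Y ⇒ᵇ indepOfᵇ (kernelᵇ (incidence H)) Y) →
    T (everySubset (E H) λ Y → ind Y ∨ any (λ C → isYes (proj₁ C ⊆? Y)) cycles) →
    I ≅ CycleMatroid H
  isomorphic-by-check H π cycles free-check cover-check = π ↔-∘ σ , λ Y → begin
    I (preimage ((π ↔-∘ σ) ⟨$⟩ʳ_) Y)                ≡⟨ cong I (preimage-∘ (σ ⟨$⟩ʳ_) (π ⟨$⟩ʳ_) Y) ⟨
    I (preimage (σ ⟨$⟩ʳ_) (preimage (π ⟨$⟩ʳ_) Y))   ≈⟨ I≈c (preimage (π ⟨$⟩ʳ_) Y) ⟩
    T (contractionᵇ c (preimage (π ⟨$⟩ʳ_) Y))       ≈⟨ cycleMatroid-by-check H (contractionᵇ c ∘ preimage (π ⟨$⟩ʳ_))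
                                                          cycles free-check cover-check Y ⟩
    CycleMatroid H Y                                ∎
    where open ⇔-Reasoning

  graphic-representation : IsGraphic I →
    ∃[ V ] Σ (Fin 7 → Fin V × Fin V) λ ends → ∀ Y → T (contractionᵇ c Y) ⇔ CycleMatroid (graph ends) Y
  graphic-representation (G , I≅G) with ≅-cycleMatroid {I = I} {G} I≅G
  ... | ends′ , I≈G′ = V G , ends′ ∘ (σ ⟨$⟩ˡ_) , λ Y → begin
    T (contractionᵇ c Y)                                      ≈⟨ I≈c Y ⟨
    I (preimage (σ ⟨$⟩ʳ_) Y)                                  ≈⟨ I≈G′ (preimage (σ ⟨$⟩ʳ_) Y) ⟩
    CycleMatroid (graph ends′) (preimage (σ ⟨$⟩ʳ_) Y)         ≈⟨ ¬-cong-⇔ (cycle-relabel (graph ends′) (↔-sym σ) _) ⟩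
    CycleMatroid G′ (preimage (σ ⟨$⟩ˡ_) (preimage (σ ⟨$⟩ʳ_) Y))
                                                              ≡⟨ cong (CycleMatroid G′) (preimage-inverse (σ ⟨$⟩ˡ_) (σ ⟨$⟩ʳ_)
                                                                                                          (λ _ → inverseʳ σ) Y) ⟩
    CycleMatroid G′ Y                                         ∎
    where
    open ⇔-Reasoning
    G′ = graph (ends′ ∘ (σ ⟨$⟩ˡ_))

  F7*-contraction-not-graphic : T (all (isCircuitᵇ (contractionᵇ c)) F7*-circuits) →
    T (every 7 λ i → every 7 λ j → contractionᵇ c (setOf (i ∷ j ∷ []))) →
    T (every 7 λ i → every 7 λ j → every 7 λ k → contractionᵇ c (setOf (i ∷ j ∷ k ∷ []))) →
    ¬ IsGraphic I
  F7*-contraction-not-graphic circuits pairs-indep triples-indep graphic with graphic-representation graphic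
  ... | _ , ends , represents = F7*-not-graphic ends (contractionᵇ c) represents
    (every²-sound 7 7 (λ i j → contractionᵇ c (setOf (i ∷ j ∷ []))) pairs-indep)
    circuits (every³-sound 7 7 7 (λ i j k → contractionᵇ c (setOf (i ∷ j ∷ k ∷ []))) triples-indep)

  F7-contraction-not-graphic : T (all (isCircuitᵇ (contractionᵇ c)) F7-circuits) →
    T (every 7 λ i → every 7 λ j → contractionᵇ c (setOf (i ∷ j ∷ []))) → ¬ IsGraphic I
  F7-contraction-not-graphic circuits pairs-indep graphic with graphic-representation graphic
  ... | _ , ends , represents = F7-not-graphic ends (contractionᵇ c) represents
    (every²-sound 7 7 (λ i j → contractionᵇ c (setOf (i ∷ j ∷ []))) pairs-indep) circuits

-- The contraction is F7* when the new element is a coloop or a loop (inSpan ∅), and F7 when its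
-- column is (1, 1, 1, 0); in all other cases it is M(G₁₀) or M(G₁₁) up to the relabelling shown.
contraction-G₁₀-or-G₁₁ : ∀ (I : IndepSys 7) (σ : Permutation 7 7) c →
                         (∀ Y → I (preimage (σ ⟨$⟩ʳ_) Y) ⇔ T (contractionᵇ c Y)) →
                         IsGraphic I → (I ≅ CycleMatroid G₁₀) ⊎ (I ≅ CycleMatroid G₁₁)
contraction-G₁₀-or-G₁₁ I σ coloop I≈c graphic =
  contradiction graphic (F7*-contraction-not-graphic I σ coloop I≈c tt tt tt)
contraction-G₁₀-or-G₁₁ I σ c@(inSpan (false ∷ false ∷ false ∷ false ∷ [])) I≈c graphic =
  contradiction graphic (F7*-contraction-not-graphic I σ c I≈c tt tt tt)
contraction-G₁₀-or-G₁₁ I σ c@(inSpan (true ∷ true ∷ true ∷ false ∷ [])) I≈c graphic =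
  contradiction graphic (F7-contraction-not-graphic I σ c I≈c tt tt)
contraction-G₁₀-or-G₁₁ I σ c@(inSpan (false ∷ false ∷ false ∷ true ∷ [])) I≈c _ =
  inj₁ (isomorphic-by-check I σ c I≈c G₁₀ (permutation (lookup (0F ∷ 1F ∷ 3F ∷ 2F ∷ 4F ∷ 5F ∷ 6F ∷ [])) tt) G₁₀-cycles tt tt)
contraction-G₁₀-or-G₁₁ I σ c@(inSpan (false ∷ false ∷ true ∷ false ∷ [])) I≈c _ =
  inj₁ (isomorphic-by-check I σ c I≈c G₁₀ (permutation (lookup (0F ∷ 1F ∷ 4F ∷ 2F ∷ 3F ∷ 6F ∷ 5F ∷ [])) tt) G₁₀-cycles tt tt)
contraction-G₁₀-or-G₁₁ I σ c@(inSpan (false ∷ false ∷ true ∷ true ∷ [])) I≈c _ =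
  inj₂ (isomorphic-by-check I σ c I≈c G₁₁ (permutation (lookup (6F ∷ 0F ∷ 2F ∷ 1F ∷ 3F ∷ 4F ∷ 5F ∷ [])) tt) G₁₁-cycles tt tt)
contraction-G₁₀-or-G₁₁ I σ c@(inSpan (false ∷ true ∷ false ∷ false ∷ [])) I≈c _ =
  inj₁ (isomorphic-by-check I σ c I≈c G₁₀ (permutation (lookup (0F ∷ 1F ∷ 5F ∷ 2F ∷ 6F ∷ 3F ∷ 4F ∷ [])) tt) G₁₀-cycles tt tt)
contraction-G₁₀-or-G₁₁ I σ c@(inSpan (false ∷ true ∷ false ∷ true ∷ [])) I≈c _ =
  inj₂ (isomorphic-by-check I σ c I≈c G₁₁ (permutation (lookup (0F ∷ 6F ∷ 2F ∷ 1F ∷ 4F ∷ 3F ∷ 5F ∷ [])) tt) G₁₁-cycles tt tt)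
contraction-G₁₀-or-G₁₁ I σ c@(inSpan (false ∷ true ∷ true ∷ false ∷ [])) I≈c _ =
  inj₂ (isomorphic-by-check I σ c I≈c G₁₁ (permutation (lookup (0F ∷ 1F ∷ 2F ∷ 6F ∷ 4F ∷ 5F ∷ 3F ∷ [])) tt) G₁₁-cycles tt tt)
contraction-G₁₀-or-G₁₁ I σ c@(inSpan (false ∷ true ∷ true ∷ true ∷ [])) I≈c _ =
  inj₁ (isomorphic-by-check I σ c I≈c G₁₀ (permutation (lookup (0F ∷ 1F ∷ 6F ∷ 2F ∷ 5F ∷ 4F ∷ 3F ∷ [])) tt) G₁₀-cycles tt tt)
contraction-G₁₀-or-G₁₁ I σ c@(inSpan (true ∷ false ∷ false ∷ false ∷ [])) I≈c _ =
  inj₁ (isomorphic-by-check I σ c I≈c G₁₀ (permutation (lookup (0F ∷ 5F ∷ 1F ∷ 6F ∷ 2F ∷ 3F ∷ 4F ∷ [])) tt) G₁₀-cycles tt tt)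
contraction-G₁₀-or-G₁₁ I σ c@(inSpan (true ∷ false ∷ false ∷ true ∷ [])) I≈c _ =
  inj₂ (isomorphic-by-check I σ c I≈c G₁₁ (permutation (lookup (0F ∷ 2F ∷ 6F ∷ 4F ∷ 1F ∷ 3F ∷ 5F ∷ [])) tt) G₁₁-cycles tt tt)
contraction-G₁₀-or-G₁₁ I σ c@(inSpan (true ∷ false ∷ true ∷ false ∷ [])) I≈c _ =
  inj₂ (isomorphic-by-check I σ c I≈c G₁₁ (permutation (lookup (0F ∷ 2F ∷ 1F ∷ 4F ∷ 6F ∷ 5F ∷ 3F ∷ [])) tt) G₁₁-cycles tt tt)
contraction-G₁₀-or-G₁₁ I σ c@(inSpan (true ∷ false ∷ true ∷ true ∷ [])) I≈c _ =
  inj₁ (isomorphic-by-check I σ c I≈c G₁₀ (permutation (lookup (0F ∷ 6F ∷ 1F ∷ 5F ∷ 2F ∷ 4F ∷ 3F ∷ [])) tt) G₁₀-cycles tt tt)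
contraction-G₁₀-or-G₁₁ I σ c@(inSpan (true ∷ true ∷ false ∷ false ∷ [])) I≈c _ =
  inj₂ (isomorphic-by-check I σ c I≈c G₁₁ (permutation (lookup (0F ∷ 2F ∷ 3F ∷ 4F ∷ 5F ∷ 6F ∷ 1F ∷ [])) tt) G₁₁-cycles tt tt)
contraction-G₁₀-or-G₁₁ I σ c@(inSpan (true ∷ true ∷ false ∷ true ∷ [])) I≈c _ =
  inj₁ (isomorphic-by-check I σ c I≈c G₁₀ (permutation (lookup (6F ∷ 0F ∷ 1F ∷ 5F ∷ 4F ∷ 2F ∷ 3F ∷ [])) tt) G₁₀-cycles tt tt)
contraction-G₁₀-or-G₁₁ I σ c@(inSpan (true ∷ true ∷ true ∷ true ∷ [])) I≈c _ =
  inj₂ (isomorphic-by-check I σ c I≈c G₁₁ (permutation (lookup (0F ∷ 2F ∷ 4F ∷ 5F ∷ 3F ∷ 1F ∷ 6F ∷ [])) tt) G₁₁-cycles tt tt)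

lemma4p2 : ∀ {n} (N : Matroid (suc n)) (a : Fin (suc n)) →
           IsBinary N →
           delete (indep N) a ≅ F7* →
           IsGraphic (contract (indep N) a) →
           (contract (indep N) a ≅ CycleMatroid G₁₀)
             ⊎ (contract (indep N) a ≅ CycleMatroid G₁₁)
lemma4p2 N a binary (σ , N\a≅F7*) graphic with ↔⇒≡ σ
... | refl = let c , N/a≈c = contraction-of-F7*-extension N a binary σ N\a≅F7*
             in contraction-G₁₀-or-G₁₁ (contract (indep N) a) σ c N/a≈c graphic
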